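{- For every non-empty index $\boldsymbol{k}$ and every non-negative integer $m$, \[ g_m(\boldsymbol{k}_{\rightarrow};t)=(1-t)g_m(\boldsymbol{k};t)_{\uparrow}+g_m(\boldsymbol{k};t)_{\rightarrow}-(1-t)g_m(\boldsymbol{k}_{\uparrow};t)+(1-t)g_{m-1}(\boldsymbol{k}_{\rightarrow\uparrow};t). \]
   Context: Let $t$ be an indeterminate and $\mathcal{I}^t$ the set of formal $\mathbb{Q}[t]$-linear combinations of indices (tuples of positive integers). For a non-empty index $\boldsymbol{k}=(k_1,\dots,k_r)$, $\boldsymbol{k}_\uparrow=(k_1,\dots,k_{r-1},k_r+1)$, $\boldsymbol{k}_\rightarrow=(k_1,\dots,k_r,1)$, and $\boldsymbol{k}_{\rightarrow\uparrow}=(\boldsymbol{k}_\rightarrow)_\uparrow=(k_1,\dots,k_r,2)$; these operations are extended $\mathbb{Q}[t]$-linearly to combinations of non-empty indices. Binomial coefficients: for integer $n$ and integer $j\ge0$, $\binom{n}{j}=n(n-1)\cdots(n-j+1)/j!$. For integers $k$, $i\ge0$, $e\ge0$, $f_i(k,e)=\sum_{j=0}^{e}\binom{e-j}{i}\binom{k+e-i-2}{j}t^j(1-t)^{e-i-j}$. For a non-empty index $\boldsymbol{k}=(k_1,\dots,k_r)$ and $m\ge0$, with $k'_j\coloneqq k_j+\delta_{j,1}$, $g_m(\boldsymbol{k};t)=\sum_{l=1}^{r}(-t(1-t))^{r-l}\sum_{(e_1,\dots,e_l)\in\mathbb{Z}_{\ge0}^l,\ \sum e_i=m}\ \sum_{1=i_1<\cdots<i_{l+1}=r+1}\prod_{l'=1}^{l}f_{i_{l'+1}-i_{l'}-1}(k'_{i_{l'}}+\cdots+k'_{i_{l'+1}-1},e_{l'})\cdot(k_{i_1}+\cdots+k_{i_2-1}+e_1,\dots,k_{i_l}+\cdots+k_{i_{l+1}-1}+e_l)$,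 and $g_{ -1}(\boldsymbol{k};t)=0$. -}

module Defs where

open import Data.Nat as ℕ using (ℕ; zero; suc; _∸_)
open import Data.Integer as ℤ using (ℤ; +_)
open import Data.Rational as ℚ using (ℚ; 0ℚ; 1ℚ)
open import Data.List using (List; []; _∷_; [_]; map; concatMap; upTo; length; zipWith; foldr; _++_)
open import Data.Nat.ListAction using (sum)
open import Data.List.Properties using (≡-dec)
open import Data.Product using (_×_; _,_)
open import Relation.Nullary using (yes; no)

-- Polynomials in Q[t]: coefficient lists (constant term first).
-- Two polynomials are compared via their coefficients (polyCoeff).

Poly : Set
Poly = List ℚ

polyAdd : Poly → Poly → Poly
polyAdd [] q = q
polyAdd (a ∷ p) [] = a ∷ p
polyAdd (a ∷ p) (b ∷ q) = (a ℚ.+ b) ∷ polyAdd p q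

polyScale : ℚ → Poly → Poly
polyScale c = map (c ℚ.*_)

polyMul : Poly → Poly → Poly
polyMul [] q = []
polyMul (a ∷ p) q = polyAdd (polyScale a q) (0ℚ ∷ polyMul p q)

polyConst : ℚ → Poly
polyConst c = c ∷ []

polyOne : Poly
polyOne = polyConst 1ℚ

tPoly : Poly
tPoly = 0ℚ ∷ 1ℚ ∷ []

oneMinusT : Poly
oneMinusT = 1ℚ ∷ ℚ.- 1ℚ ∷ []

polyPow : Poly → ℕ → Poly
polyPow p zero = polyOne
polyPow p (suc n) = polyMul p (polyPow p n)

polyCoeff : Poly → ℕ → ℚ
polyCoeff [] d = 0ℚ
polyCoeff (a ∷ p) zero = a
polyCoeff (a ∷ p) (suc d) = polyCoeff p d

polySum : List Poly → Poly
polySum = foldr polyAdd []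

polyProd : List Poly → Poly
polyProd = foldr polyMul polyOne

binom : ℤ → ℕ → ℚ
binom n zero = 1ℚ
binom n (suc j) = binom n j ℚ.* ((n ℤ.- + j) ℚ./ suc j)

Index : Set
Index = List ℕ

-- a combination is a finite formal sum  Σ p_i · κ_i  (list of terms)
Comb : Set
Comb = List (Poly × Index)

combZero : Comb
combZero = []

combAdd : Comb → Comb → Comb
combAdd = _++_

combScale : Poly → Comb → Comb
combScale q = map (λ { (p , κ) → (polyMul q p , κ) })

combNeg : Comb → Comb
combNeg = combScale (polyConst (ℚ.- 1ℚ))

combSub : Comb → Comb → Comb
combSub a b = combAdd a (combNeg b)

combCoeff : Comb → Index → ℕ → ℚ
combCoeff [] κ d = 0ℚ
combCoeff ((p , λ') ∷ c) κ d with ≡-dec ℕ._≟_ λ' κ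
... | yes _ = polyCoeff p d ℚ.+ combCoeff c κ d
... | no  _ = combCoeff c κ d

_≈ᶜ_ : Comb → Comb → Set
a ≈ᶜ b = ∀ (κ : Index) (d : ℕ) → combCoeff a κ d ≡ combCoeff b κ d
  where open import Relation.Binary.PropositionalEquality using (_≡_)

-- index operations  k↑ (last entry +1) and k→ (append 1)
-- (on the empty index ↑ is junk and is never used)

idxUp : Index → Index
idxUp [] = []
idxUp (x ∷ []) = suc x ∷ []
idxUp (x ∷ y ∷ ys) = x ∷ idxUp (y ∷ ys)

idxRight : Index → Index
idxRight k = k ++ [ 1 ]

idxRightUp : Index → Index
idxRightUp k = idxUp (idxRight k)

combUp : Comb → Comb
combUp = map (λ { (p , κ) → (p , idxUp κ) })

combRight : Comb → Comb
combRight = map (λ { (p , κ) → (p , idxRight κ) })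

-- f_i(k,e) = Σ_{j=0}^{e} binom(e-j, i) binom(k+e-i-2, j) t^j (1-t)^{e-i-j}
-- (when e-i-j < 0 we have binom(e-j,i) = 0, so the exponent is immaterial;
--  truncated subtraction is used there)

fPoly : ℕ → ℤ → ℕ → Poly
fPoly i k e = polySum (map term (upTo (suc e)))
  where
  term : ℕ → Poly
  term j = polyMul (polyConst (binom (+ (e ∸ j)) i ℚ.* binom (((k ℤ.+ + e) ℤ.- + i) ℤ.- + 2) j))
                   (polyMul (polyPow tPoly j) (polyPow oneMinusT ((e ∸ i) ∸ j)))

-- Splittings 1 = i_1 < ... < i_{l+1} = r+1 of k into l consecutive
-- non-empty blocks (k_{i_1..i_2-1}), ..., (k_{i_l..i_{l+1}-1})

splits : Index → List (List Index)
splits [] = [] ∷ []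
splits (x ∷ xs) = concatMap step (splits xs)
  where
  step : List Index → List (List Index)
  step [] = ((x ∷ []) ∷ []) ∷ []
  step (b ∷ bs) = ((x ∷ []) ∷ b ∷ bs) ∷ ((x ∷ b) ∷ bs) ∷ []

weakComps : ℕ → ℕ → List (List ℕ)
weakComps zero zero = [] ∷ []
weakComps (suc m) zero = []
weakComps m (suc l) = concatMap (λ e → map (e ∷_) (weakComps (m ∸ e) l)) (upTo (suc m))

-- product Π f_{|block|-1}(k'-sum of block, e) ; k' adds 1 to the first entry,
-- i.e. to the sum of the first block only
fProd : ℕ → List Index → List ℕ → Poly
fProd first [] es = polyOne
fProd first (b ∷ bs) [] = polyOne
fProd first (b ∷ bs) (e ∷ es) =
  polyMul (fPoly (length b ∸ 1) (+ (sum b ℕ.+ first)) e) (fProd 0 bs es)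

blockIndex : List Index → List ℕ → Index
blockIndex bs es = zipWith (λ b e → sum b ℕ.+ e) bs es

g : ℕ → Index → Comb
g m k = concatMap perSplit (splits k)
  where
  perSplit : List Index → Comb
  perSplit B = map (λ es → ( polyMul (polyPow (polyMul (polyConst (ℚ.- 1ℚ)) (polyMul tPoly oneMinusT))
                                              (length k ∸ length B))
                                     (fProd 1 B es)
                           , blockIndex B es))
                   (weakComps m (length B))

-- g_{m-1}, with g_{-1} = 0
gPred : ℕ → Index → Comb
gPred zero k = combZero
gPred (suc m) k = g m k

-- Every splitting of k ++ [1] arises from a splitting C ++ [b] of k in one of two ways: [1] becomes a
-- new last block, or 1 is appended to the last block b. Summing over weak compositions block by block
-- (the first blocks are peeled off by induction, their factors collected in Q and their entries in π)
-- reduces the proposition to the last block. For a new block, f_0(1, 0) = 1 yields the terms of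
-- g_m(k)→, and f_0(1, e + 1) = 1 − t = (1 − t) f_0(2, e) yields the terms of (1 − t) g_{m−1}(k→↑) in
-- which [2] is a new block. For an extended block, which carries an extra factor −t(1 − t), the
-- remaining three terms match by the recurrence
--   f_i(k, e + 1) + t f_{i+1}(k + 1, e + 1) = f_i(k + 1, e + 1) + t(1 − t) f_{i+1}(k + 2, e),
-- which is Pascal's rule applied to each of the two binomial coefficients in f.

module Submission where

open import Defs
open import Data.Nat using (ℕ; _≤_)
open import Data.List using (List; _∷_)
open import Data.List.Relation.Unary.All using (All)

module Polynomials where

  open import Defs
  open import Data.Nat using (zero; suc)
  open import Data.Rational as ℚ using (0ℚ; 1ℚ)
  import Data.Rational.Properties as ℚP
  open import Data.List using ([]; _∷_)
  open import Data.Product using (_×_; _,_)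
  open import Data.Maybe using (Maybe; just; nothing)
  open import Relation.Nullary using (yes)
  open import Relation.Binary.PropositionalEquality
  open import Relation.Binary.Bundles using (Setoid)
  import Relation.Binary.Reasoning.Setoid
  open import Relation.Binary.Structures using (IsEquivalence)
  open import Algebra.Bundles using (CommutativeRing)
  import Tactic.RingSolver.Core.AlmostCommutativeRing as ACR

  -- a record rather than a Π-type, so that p and q can be inferred from a proof
  infix 4 _≈ₚ_
  record _≈ₚ_ (p q : Poly) : Set where
    constructor mk≈ₚ
    field coeff-≡ : ∀ d → polyCoeff p d ≡ polyCoeff q d
  open _≈ₚ_ public

  ≈ₚ-isEquivalence : IsEquivalence _≈ₚ_
  ≈ₚ-isEquivalence = record
    { refl  = mk≈ₚ λ _ → refl
    ; sym   = λ p≈q → mk≈ₚ λ d → sym (coeff-≡ p≈q d)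
    ; trans = λ p≈q q≈r → mk≈ₚ λ d → trans (coeff-≡ p≈q d) (coeff-≡ q≈r d)
    }

  ≈ₚ-setoid : Setoid _ _
  ≈ₚ-setoid = record { isEquivalence = ≈ₚ-isEquivalence }

  open IsEquivalence ≈ₚ-isEquivalence public
    renaming (refl to ≈ₚ-refl; sym to ≈ₚ-sym; trans to ≈ₚ-trans; reflexive to ≡⇒≈ₚ)

  module ≈ₚ-Reasoning = Relation.Binary.Reasoning.Setoid ≈ₚ-setoid

  coeff-polyAdd : ∀ p q d → polyCoeff (polyAdd p q) d ≡ polyCoeff p d ℚ.+ polyCoeff q d
  coeff-polyAdd []      q       d       = sym (ℚP.+-identityˡ _)
  coeff-polyAdd (a ∷ p) []      d       = sym (ℚP.+-identityʳ _)
  coeff-polyAdd (a ∷ p) (b ∷ q) zero    = refl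
  coeff-polyAdd (a ∷ p) (b ∷ q) (suc d) = coeff-polyAdd p q d

  coeff-polyScale : ∀ c p d → polyCoeff (polyScale c p) d ≡ c ℚ.* polyCoeff p d
  coeff-polyScale c []      d       = sym (ℚP.*-zeroʳ c)
  coeff-polyScale c (a ∷ p) zero    = refl
  coeff-polyScale c (a ∷ p) (suc d) = coeff-polyScale c p d

  ∷-cong : ∀ {a b p q} → a ≡ b → p ≈ₚ q → (a ∷ p) ≈ₚ (b ∷ q)
  ∷-cong refl p≈q = mk≈ₚ λ { zero → refl ; (suc d) → coeff-≡ p≈q d }

  0∷-cong-[] : ∀ {p} → p ≈ₚ [] → (0ℚ ∷ p) ≈ₚ []
  0∷-cong-[] p≈[] = mk≈ₚ λ { zero → refl ; (suc d) → coeff-≡ p≈[] d }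

  polyAdd-cong : ∀ {p p′ q q′} → p ≈ₚ p′ → q ≈ₚ q′ → polyAdd p q ≈ₚ polyAdd p′ q′
  polyAdd-cong {p} {p′} {q} {q′} p≈p′ q≈q′ = mk≈ₚ λ d → begin
    polyCoeff (polyAdd p q) d             ≡⟨ coeff-polyAdd p q d ⟩
    polyCoeff p d ℚ.+ polyCoeff q d       ≡⟨ cong₂ ℚ._+_ (coeff-≡ p≈p′ d) (coeff-≡ q≈q′ d) ⟩
    polyCoeff p′ d ℚ.+ polyCoeff q′ d     ≡⟨ coeff-polyAdd p′ q′ d ⟨
    polyCoeff (polyAdd p′ q′) d           ∎
    where open ≡-Reasoning

  polyAdd-congˡ : ∀ p {q q′} → q ≈ₚ q′ → polyAdd p q ≈ₚ polyAdd p q′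
  polyAdd-congˡ p = polyAdd-cong (≈ₚ-refl {p})

  polyAdd-congʳ : ∀ r {p p′} → p ≈ₚ p′ → polyAdd p r ≈ₚ polyAdd p′ r
  polyAdd-congʳ r p≈p′ = polyAdd-cong p≈p′ (≈ₚ-refl {r})

  polyAdd-identityʳ : ∀ p → polyAdd p [] ≈ₚ p
  polyAdd-identityʳ []      = ≈ₚ-refl
  polyAdd-identityʳ (a ∷ p) = ≈ₚ-refl

  polyAdd-comm : ∀ p q → polyAdd p q ≈ₚ polyAdd q p
  polyAdd-comm p q = mk≈ₚ λ d → begin
    polyCoeff (polyAdd p q) d         ≡⟨ coeff-polyAdd p q d ⟩
    polyCoeff p d ℚ.+ polyCoeff q d   ≡⟨ ℚP.+-comm (polyCoeff p d) (polyCoeff q d) ⟩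
    polyCoeff q d ℚ.+ polyCoeff p d   ≡⟨ coeff-polyAdd q p d ⟨
    polyCoeff (polyAdd q p) d         ∎
    where open ≡-Reasoning

  polyAdd-assoc : ∀ p q r → polyAdd (polyAdd p q) r ≈ₚ polyAdd p (polyAdd q r)
  polyAdd-assoc p q r = mk≈ₚ λ d → begin
    polyCoeff (polyAdd (polyAdd p q) r) d                      ≡⟨ coeff-polyAdd (polyAdd p q) r d ⟩
    polyCoeff (polyAdd p q) d ℚ.+ polyCoeff r d                ≡⟨ cong (ℚ._+ polyCoeff r d) (coeff-polyAdd p q d) ⟩
    (polyCoeff p d ℚ.+ polyCoeff q d) ℚ.+ polyCoeff r d        ≡⟨ ℚP.+-assoc (polyCoeff p d) (polyCoeff q d) (polyCoeff r d) ⟩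
    polyCoeff p d ℚ.+ (polyCoeff q d ℚ.+ polyCoeff r d)        ≡⟨ cong (polyCoeff p d ℚ.+_) (coeff-polyAdd q r d) ⟨
    polyCoeff p d ℚ.+ polyCoeff (polyAdd q r) d                ≡⟨ coeff-polyAdd p (polyAdd q r) d ⟨
    polyCoeff (polyAdd p (polyAdd q r)) d                      ∎
    where open ≡-Reasoning

  polyAdd-middleFour : ∀ p q r s → polyAdd (polyAdd p q) (polyAdd r s) ≈ₚ polyAdd (polyAdd p r) (polyAdd q s)
  polyAdd-middleFour p q r s = begin
    polyAdd (polyAdd p q) (polyAdd r s)   ≈⟨ polyAdd-assoc p q _ ⟩
    polyAdd p (polyAdd q (polyAdd r s))   ≈⟨ polyAdd-congˡ p (polyAdd-assoc q r s) ⟨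
    polyAdd p (polyAdd (polyAdd q r) s)   ≈⟨ polyAdd-congˡ p (polyAdd-congʳ s (polyAdd-comm q r)) ⟩
    polyAdd p (polyAdd (polyAdd r q) s)   ≈⟨ polyAdd-congˡ p (polyAdd-assoc r q s) ⟩
    polyAdd p (polyAdd r (polyAdd q s))   ≈⟨ polyAdd-assoc p r _ ⟨
    polyAdd (polyAdd p r) (polyAdd q s)   ∎
    where open ≈ₚ-Reasoning

  polyAdd-leftCommute : ∀ p q r → polyAdd p (polyAdd q r) ≈ₚ polyAdd q (polyAdd p r)
  polyAdd-leftCommute p q r = begin
    polyAdd p (polyAdd q r)   ≈⟨ polyAdd-assoc p q r ⟨
    polyAdd (polyAdd p q) r   ≈⟨ polyAdd-congʳ r (polyAdd-comm p q) ⟩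
    polyAdd (polyAdd q p) r   ≈⟨ polyAdd-assoc q p r ⟩
    polyAdd q (polyAdd p r)   ∎
    where open ≈ₚ-Reasoning

  polyScale-cong : ∀ c {p q} → p ≈ₚ q → polyScale c p ≈ₚ polyScale c q
  polyScale-cong c {p} {q} p≈q = mk≈ₚ λ d → begin
    polyCoeff (polyScale c p) d   ≡⟨ coeff-polyScale c p d ⟩
    c ℚ.* polyCoeff p d           ≡⟨ cong (c ℚ.*_) (coeff-≡ p≈q d) ⟩
    c ℚ.* polyCoeff q d           ≡⟨ coeff-polyScale c q d ⟨
    polyCoeff (polyScale c q) d   ∎
    where open ≡-Reasoning

  polyScale-zero : ∀ p → polyScale 0ℚ p ≈ₚ []
  polyScale-zero p = mk≈ₚ λ d → trans (coeff-polyScale 0ℚ p d) (ℚP.*-zeroˡ (polyCoeff p d))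

  polyScale-distribˡ : ∀ c p q → polyScale c (polyAdd p q) ≈ₚ polyAdd (polyScale c p) (polyScale c q)
  polyScale-distribˡ c p q = mk≈ₚ λ d → begin
    polyCoeff (polyScale c (polyAdd p q)) d                          ≡⟨ coeff-polyScale c (polyAdd p q) d ⟩
    c ℚ.* polyCoeff (polyAdd p q) d                                  ≡⟨ cong (c ℚ.*_) (coeff-polyAdd p q d) ⟩
    c ℚ.* (polyCoeff p d ℚ.+ polyCoeff q d)                          ≡⟨ ℚP.*-distribˡ-+ c _ _ ⟩
    c ℚ.* polyCoeff p d ℚ.+ c ℚ.* polyCoeff q d                      ≡⟨ cong₂ ℚ._+_ (coeff-polyScale c p d) (coeff-polyScale c q d) ⟨
    polyCoeff (polyScale c p) d ℚ.+ polyCoeff (polyScale c q) d      ≡⟨ coeff-polyAdd (polyScale c p) (polyScale c q) d ⟨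
    polyCoeff (polyAdd (polyScale c p) (polyScale c q)) d            ∎
    where open ≡-Reasoning

  polyScale-distribʳ : ∀ a b p → polyScale (a ℚ.+ b) p ≈ₚ polyAdd (polyScale a p) (polyScale b p)
  polyScale-distribʳ a b p = mk≈ₚ λ d → begin
    polyCoeff (polyScale (a ℚ.+ b) p) d                              ≡⟨ coeff-polyScale (a ℚ.+ b) p d ⟩
    (a ℚ.+ b) ℚ.* polyCoeff p d                                      ≡⟨ ℚP.*-distribʳ-+ (polyCoeff p d) a b ⟩
    a ℚ.* polyCoeff p d ℚ.+ b ℚ.* polyCoeff p d                      ≡⟨ cong₂ ℚ._+_ (coeff-polyScale a p d) (coeff-polyScale b p d) ⟨
    polyCoeff (polyScale a p) d ℚ.+ polyCoeff (polyScale b p) d      ≡⟨ coeff-polyAdd (polyScale a p) (polyScale b p) d ⟨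
    polyCoeff (polyAdd (polyScale a p) (polyScale b p)) d            ∎
    where open ≡-Reasoning

  polyScale-assoc : ∀ a b p → polyScale (a ℚ.* b) p ≈ₚ polyScale a (polyScale b p)
  polyScale-assoc a b p = mk≈ₚ λ d → begin
    polyCoeff (polyScale (a ℚ.* b) p) d   ≡⟨ coeff-polyScale (a ℚ.* b) p d ⟩
    a ℚ.* b ℚ.* polyCoeff p d             ≡⟨ ℚP.*-assoc a b (polyCoeff p d) ⟩
    a ℚ.* (b ℚ.* polyCoeff p d)           ≡⟨ cong (a ℚ.*_) (coeff-polyScale b p d) ⟨
    a ℚ.* polyCoeff (polyScale b p) d     ≡⟨ coeff-polyScale a (polyScale b p) d ⟨
    polyCoeff (polyScale a (polyScale b p)) d ∎
    where open ≡-Reasoning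

  polyScale-identity : ∀ p → polyScale 1ℚ p ≈ₚ p
  polyScale-identity p = mk≈ₚ λ d → trans (coeff-polyScale 1ℚ p d) (ℚP.*-identityˡ (polyCoeff p d))

  ≈ₚ-∷⁻ : ∀ {a b p q} → (a ∷ p) ≈ₚ (b ∷ q) → a ≡ b × p ≈ₚ q
  ≈ₚ-∷⁻ a∷p≈b∷q = coeff-≡ a∷p≈b∷q 0 , mk≈ₚ λ d → coeff-≡ a∷p≈b∷q (suc d)

  []≈ₚ∷⁻ : ∀ {b q} → [] ≈ₚ (b ∷ q) → 0ℚ ≡ b × [] ≈ₚ q
  []≈ₚ∷⁻ []≈b∷q = coeff-≡ []≈b∷q 0 , mk≈ₚ λ d → coeff-≡ []≈b∷q (suc d)

  polyMul-zeroʳ : ∀ p → polyMul p [] ≈ₚ []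
  polyMul-zeroʳ []      = ≈ₚ-refl
  polyMul-zeroʳ (a ∷ p) = 0∷-cong-[] (polyMul-zeroʳ p)

  private
    polyMul-∷-cong : ∀ {a b} p q r → a ≡ b → polyMul p r ≈ₚ polyMul q r → polyMul (a ∷ p) r ≈ₚ polyMul (b ∷ q) r
    polyMul-∷-cong p q r refl pr≈qr = polyAdd-congˡ _ (∷-cong refl pr≈qr)

    polyMul-zero∷[] : ∀ r → polyMul (0ℚ ∷ []) r ≈ₚ []
    polyMul-zero∷[] r = polyAdd-cong (polyScale-zero r) (0∷-cong-[] ≈ₚ-refl)

  polyMul-congʳ : ∀ r {p q} → p ≈ₚ q → polyMul p r ≈ₚ polyMul q r
  polyMul-congʳ r {[]}    {[]}    _   = ≈ₚ-refl
  polyMul-congʳ r {[]}    {b ∷ q} p≈q with []≈ₚ∷⁻ p≈q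
  ... | 0≡b , []≈q = ≈ₚ-trans (≈ₚ-sym (polyMul-zero∷[] r)) (polyMul-∷-cong [] q r 0≡b (polyMul-congʳ r []≈q))
  polyMul-congʳ r {a ∷ p} {[]}    p≈q with []≈ₚ∷⁻ (≈ₚ-sym p≈q)
  ... | 0≡a , []≈p = ≈ₚ-trans (polyMul-∷-cong p [] r (sym 0≡a) (polyMul-congʳ r (≈ₚ-sym []≈p))) (polyMul-zero∷[] r)
  polyMul-congʳ r {a ∷ p} {b ∷ q} p≈q with ≈ₚ-∷⁻ p≈q
  ... | a≡b , p≈q′ = polyMul-∷-cong p q r a≡b (polyMul-congʳ r p≈q′)

  polyMul-∷ʳ : ∀ p b q → polyMul p (b ∷ q) ≈ₚ polyAdd (polyScale b p) (0ℚ ∷ polyMul p q)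
  polyMul-∷ʳ []      b q = ≈ₚ-sym (0∷-cong-[] ≈ₚ-refl)
  polyMul-∷ʳ (a ∷ p) b q = ∷-cong (cong (ℚ._+ 0ℚ) (ℚP.*-comm a b)) (begin
    polyAdd (polyScale a q) (polyMul p (b ∷ q))                         ≈⟨ polyAdd-congˡ (polyScale a q) (polyMul-∷ʳ p b q) ⟩
    polyAdd (polyScale a q) (polyAdd (polyScale b p) (0ℚ ∷ polyMul p q)) ≈⟨ polyAdd-leftCommute (polyScale a q) (polyScale b p) _ ⟩
    polyAdd (polyScale b p) (polyAdd (polyScale a q) (0ℚ ∷ polyMul p q)) ∎)
    where open ≈ₚ-Reasoning

  polyMul-comm : ∀ p q → polyMul p q ≈ₚ polyMul q p
  polyMul-comm []      q = ≈ₚ-sym (polyMul-zeroʳ q)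
  polyMul-comm (a ∷ p) q = begin
    polyAdd (polyScale a q) (0ℚ ∷ polyMul p q)   ≈⟨ polyAdd-congˡ (polyScale a q) (∷-cong refl (polyMul-comm p q)) ⟩
    polyAdd (polyScale a q) (0ℚ ∷ polyMul q p)   ≈⟨ polyMul-∷ʳ q a p ⟨
    polyMul q (a ∷ p)                            ∎
    where open ≈ₚ-Reasoning

  polyMul-congˡ : ∀ p {q r} → q ≈ₚ r → polyMul p q ≈ₚ polyMul p r
  polyMul-congˡ p {q} {r} q≈r = begin
    polyMul p q   ≈⟨ polyMul-comm p q ⟩
    polyMul q p   ≈⟨ polyMul-congʳ p q≈r ⟩
    polyMul r p   ≈⟨ polyMul-comm r p ⟩
    polyMul p r   ∎
    where open ≈ₚ-Reasoning

  polyMul-distribʳ : ∀ r p q → polyMul (polyAdd p q) r ≈ₚ polyAdd (polyMul p r) (polyMul q r)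
  polyMul-distribʳ r []      q       = ≈ₚ-refl
  polyMul-distribʳ r (a ∷ p) []      = ≈ₚ-sym (polyAdd-identityʳ (polyMul (a ∷ p) r))
  polyMul-distribʳ r (a ∷ p) (b ∷ q) = begin
    polyAdd (polyScale (a ℚ.+ b) r) (0ℚ ∷ polyMul (polyAdd p q) r)
      ≈⟨ polyAdd-cong (polyScale-distribʳ a b r) (∷-cong (sym (ℚP.+-identityʳ 0ℚ)) (polyMul-distribʳ r p q)) ⟩
    polyAdd (polyAdd (polyScale a r) (polyScale b r)) (polyAdd (0ℚ ∷ polyMul p r) (0ℚ ∷ polyMul q r))
      ≈⟨ polyAdd-middleFour (polyScale a r) (polyScale b r) _ _ ⟩
    polyAdd (polyMul (a ∷ p) r) (polyMul (b ∷ q) r) ∎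
    where open ≈ₚ-Reasoning

  polyMul-distribˡ : ∀ r p q → polyMul r (polyAdd p q) ≈ₚ polyAdd (polyMul r p) (polyMul r q)
  polyMul-distribˡ r p q = begin
    polyMul r (polyAdd p q)                 ≈⟨ polyMul-comm r (polyAdd p q) ⟩
    polyMul (polyAdd p q) r                 ≈⟨ polyMul-distribʳ r p q ⟩
    polyAdd (polyMul p r) (polyMul q r)     ≈⟨ polyAdd-cong (polyMul-comm p r) (polyMul-comm q r) ⟩
    polyAdd (polyMul r p) (polyMul r q)     ∎
    where open ≈ₚ-Reasoning

  polyMul-polyScaleˡ : ∀ c p q → polyMul (polyScale c p) q ≈ₚ polyScale c (polyMul p q)
  polyMul-polyScaleˡ c []      q = ≈ₚ-refl
  polyMul-polyScaleˡ c (a ∷ p) q = begin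
    polyAdd (polyScale (c ℚ.* a) q) (0ℚ ∷ polyMul (polyScale c p) q)
      ≈⟨ polyAdd-cong (polyScale-assoc c a q) (∷-cong (sym (ℚP.*-zeroʳ c)) (polyMul-polyScaleˡ c p q)) ⟩
    polyAdd (polyScale c (polyScale a q)) (polyScale c (0ℚ ∷ polyMul p q))
      ≈⟨ polyScale-distribˡ c (polyScale a q) _ ⟨
    polyScale c (polyMul (a ∷ p) q) ∎
    where open ≈ₚ-Reasoning

  polyMul-assoc : ∀ p q r → polyMul (polyMul p q) r ≈ₚ polyMul p (polyMul q r)
  polyMul-assoc []      q r = ≈ₚ-refl
  polyMul-assoc (a ∷ p) q r = begin
    polyMul (polyAdd (polyScale a q) (0ℚ ∷ polyMul p q)) r
      ≈⟨ polyMul-distribʳ r (polyScale a q) _ ⟩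
    polyAdd (polyMul (polyScale a q) r) (polyAdd (polyScale 0ℚ r) (0ℚ ∷ polyMul (polyMul p q) r))
      ≈⟨ polyAdd-cong (polyMul-polyScaleˡ a q r) (polyAdd-cong (polyScale-zero r) (∷-cong refl (polyMul-assoc p q r))) ⟩
    polyMul (a ∷ p) (polyMul q r) ∎
    where open ≈ₚ-Reasoning

  polyMul-identityˡ : ∀ p → polyMul polyOne p ≈ₚ p
  polyMul-identityˡ p = ≈ₚ-trans (polyAdd-cong (polyScale-identity p) (0∷-cong-[] ≈ₚ-refl)) (polyAdd-identityʳ p)

  polyMul-identityʳ : ∀ p → polyMul p polyOne ≈ₚ p
  polyMul-identityʳ p = ≈ₚ-trans (polyMul-comm p polyOne) (polyMul-identityˡ p)

  polyNeg : Poly → Poly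
  polyNeg = polyScale (ℚ.- 1ℚ)

  polyNeg-inverseʳ : ∀ p → polyAdd p (polyNeg p) ≈ₚ []
  polyNeg-inverseʳ p = begin
    polyAdd p (polyNeg p)                               ≈⟨ polyAdd-congʳ (polyNeg p) (polyScale-identity p) ⟨
    polyAdd (polyScale 1ℚ p) (polyScale (ℚ.- 1ℚ) p)      ≈⟨ polyScale-distribʳ 1ℚ (ℚ.- 1ℚ) p ⟨
    polyScale (1ℚ ℚ.+ ℚ.- 1ℚ) p                          ≡⟨ cong (λ c → polyScale c p) (ℚP.+-inverseʳ 1ℚ) ⟩
    polyScale 0ℚ p                                      ≈⟨ polyScale-zero p ⟩
    []                                                  ∎
    where open ≈ₚ-Reasoning

  polyCommutativeRing : CommutativeRing _ _
  polyCommutativeRing = record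
    { Carrier = Poly ; _≈_ = _≈ₚ_ ; _+_ = polyAdd ; _*_ = polyMul ; -_ = polyNeg ; 0# = [] ; 1# = polyOne
    ; isCommutativeRing = record
      { isRing = record
        { +-isAbelianGroup = record
          { isGroup = record
            { isMonoid = record
              { isSemigroup = record
                { isMagma = record { isEquivalence = ≈ₚ-isEquivalence ; ∙-cong = polyAdd-cong }
                ; assoc = polyAdd-assoc }
              ; identity = (λ _ → ≈ₚ-refl) , polyAdd-identityʳ }
            ; inverse = (λ p → ≈ₚ-trans (polyAdd-comm (polyNeg p) p) (polyNeg-inverseʳ p)) , polyNeg-inverseʳ
            ; ⁻¹-cong = polyScale-cong (ℚ.- 1ℚ) }
          ; comm = polyAdd-comm }
        ; *-cong = λ {p} {p′} {q} {q′} p≈p′ q≈q′ → ≈ₚ-trans (polyMul-congʳ q p≈p′) (polyMul-congˡ p′ q≈q′)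
        ; *-assoc = polyMul-assoc
        ; *-identity = polyMul-identityˡ , polyMul-identityʳ
        ; distrib = polyMul-distribˡ , polyMul-distribʳ }
      ; *-comm = polyMul-comm } }

  []≈ₚ? : ∀ p → Maybe ([] ≈ₚ p)
  []≈ₚ? []      = just ≈ₚ-refl
  []≈ₚ? (a ∷ p) with 0ℚ ℚ.≟ a | []≈ₚ? p
  ... | yes 0≡a | just []≈p = just (≈ₚ-trans (≈ₚ-sym (0∷-cong-[] ≈ₚ-refl)) (∷-cong 0≡a []≈p))
  ... | _       | _         = nothing

  -- the zero test lets the ring solver cancel coefficients such as 1 - 1
  polyAlmostCommutativeRing : ACR.AlmostCommutativeRing _ _
  polyAlmostCommutativeRing = ACR.fromCommutativeRing polyCommutativeRing []≈ₚ?

  polyMul-polyConst : ∀ c p → polyMul (polyConst c) p ≈ₚ polyScale c p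
  polyMul-polyConst c p = ≈ₚ-trans (polyAdd-congˡ (polyScale c p) (0∷-cong-[] ≈ₚ-refl)) (polyAdd-identityʳ (polyScale c p))

  polyMul-neg-one : ∀ p → polyMul (polyConst (ℚ.- 1ℚ)) p ≈ₚ polyNeg p
  polyMul-neg-one = polyMul-polyConst (ℚ.- 1ℚ)

module Binomials where

  open import Defs
  open import Data.Nat as ℕ using (zero; suc)
  import Data.Nat.Properties as ℕP
  open import Data.Integer as ℤ using (ℤ; +_)
  import Data.Integer.Properties as ℤP
  open import Data.Integer.Solver using () renaming (module +-*-Solver to ℤ-Solver)
  open import Data.Rational as ℚ using (ℚ; 0ℚ; 1ℚ; toℚᵘ)
  import Data.Rational.Properties as ℚP
  open import Data.Rational.Solver using () renaming (module +-*-Solver to ℚ-Solver)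
  open import Data.Rational.Unnormalised as ℚᵘ using (mkℚᵘ; *≡*)
  import Data.Rational.Unnormalised.Properties as ℚᵘP
  open import Data.Sum using (inj₁; inj₂)
  open import Relation.Binary.PropositionalEquality

  fromℤ : ℤ → ℚ
  fromℤ z = z ℚ./ 1

  private
    toℚᵘ-/ : ∀ x n → toℚᵘ (x ℚ./ suc n) ℚᵘ.≃ mkℚᵘ x n
    toℚᵘ-/ x n = ℚP.toℚᵘ-fromℚᵘ (mkℚᵘ x n)

    ≡-via-ℚᵘ : ∀ {p q u v} → toℚᵘ p ℚᵘ.≃ u → toℚᵘ q ℚᵘ.≃ v → u ℚᵘ.≃ v → p ≡ q
    ≡-via-ℚᵘ p≃u q≃v u≃v = ℚP.toℚᵘ-injective (ℚᵘP.≃-trans p≃u (ℚᵘP.≃-trans u≃v (ℚᵘP.≃-sym q≃v)))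

  fromℤ-+ : ∀ a b → fromℤ (a ℤ.+ b) ≡ fromℤ a ℚ.+ fromℤ b
  fromℤ-+ a b = ≡-via-ℚᵘ (toℚᵘ-/ (a ℤ.+ b) 0)
    (ℚᵘP.≃-trans (ℚP.toℚᵘ-homo-+ (fromℤ a) (fromℤ b)) (ℚᵘP.+-cong (toℚᵘ-/ a 0) (toℚᵘ-/ b 0)))
    (*≡* (ℤ-Solver.solve 2 (λ a b → (a :+ b) :* con (+ 1) := (a :* con (+ 1) :+ b :* con (+ 1)) :* con (+ 1)) refl a b))
    where open ℤ-Solver using (_:+_; _:*_; _:=_; con)

  fromℤ-neg : ∀ a → fromℤ (ℤ.- a) ≡ ℚ.- fromℤ a
  fromℤ-neg a = ≡-via-ℚᵘ (toℚᵘ-/ (ℤ.- a) 0)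
    (ℚᵘP.≃-trans (ℚP.toℚᵘ-homo‿- (fromℤ a)) (ℚᵘP.-‿cong (toℚᵘ-/ a 0))) (*≡* refl)

  fromℤ-sub : ∀ a b → fromℤ (a ℤ.- b) ≡ fromℤ a ℚ.- fromℤ b
  fromℤ-sub a b = trans (fromℤ-+ a (ℤ.- b)) (cong (fromℤ a ℚ.+_) (fromℤ-neg b))

  fromℤ-*-/ : ∀ x j → fromℤ (+ suc j) ℚ.* (x ℚ./ suc j) ≡ fromℤ x
  fromℤ-*-/ x j = ≡-via-ℚᵘ
    (ℚᵘP.≃-trans (ℚP.toℚᵘ-homo-* (fromℤ (+ suc j)) (x ℚ./ suc j)) (ℚᵘP.*-cong (toℚᵘ-/ (+ suc j) 0) (toℚᵘ-/ x j)))
    (toℚᵘ-/ x 0)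
    (*≡* (trans (ℤP.*-identityʳ _) (trans (ℤP.*-comm (+ suc j) x) (cong (λ n → x ℤ.* + suc n) (sym (ℕP.+-identityʳ j))))))

  fromℤ-suc-cancel : ∀ j {x y} → fromℤ (+ suc j) ℚ.* x ≡ fromℤ (+ suc j) ℚ.* y → x ≡ y
  fromℤ-suc-cancel j {x} {y} eq = begin
    x                                 ≡⟨ scale x ⟨
    x ℚ.* fromℤ (+ suc j) ℚ.* w        ≡⟨ cong (ℚ._* w) (trans (ℚP.*-comm x a) (trans eq (ℚP.*-comm a y))) ⟩
    y ℚ.* fromℤ (+ suc j) ℚ.* w        ≡⟨ scale y ⟩
    y                                 ∎
    where
    open ≡-Reasoning
    a = fromℤ (+ suc j)
    w = + 1 ℚ./ suc j
    scale : ∀ z → z ℚ.* fromℤ (+ suc j) ℚ.* w ≡ z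
    scale z = trans (ℚP.*-assoc z a w) (trans (cong (z ℚ.*_) (fromℤ-*-/ (+ 1) j)) (ℚP.*-identityʳ z))

  suc-*-binom-suc : ∀ n j → fromℤ (+ suc j) ℚ.* binom n (suc j) ≡ fromℤ (n ℤ.- + j) ℚ.* binom n j
  suc-*-binom-suc n j = begin
    a ℚ.* (c ℚ.* ((n ℤ.- + j) ℚ./ suc j))   ≡⟨ ℚ-Solver.solve 3 (λ a c q → a :* (c :* q) := c :* (a :* q)) refl a c ((n ℤ.- + j) ℚ./ suc j) ⟩
    c ℚ.* (a ℚ.* ((n ℤ.- + j) ℚ./ suc j))   ≡⟨ cong (c ℚ.*_) (fromℤ-*-/ (n ℤ.- + j) j) ⟩
    c ℚ.* fromℤ (n ℤ.- + j)                 ≡⟨ ℚP.*-comm c (fromℤ (n ℤ.- + j)) ⟩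
    fromℤ (n ℤ.- + j) ℚ.* c                 ∎
    where
    open ≡-Reasoning
    open ℚ-Solver using (_:*_; _:=_)
    a = fromℤ (+ suc j)
    c = binom n j

  private
    fromℤ-suc : ∀ j → fromℤ (+ suc j) ≡ fromℤ (+ j) ℚ.+ 1ℚ
    fromℤ-suc j = trans (fromℤ-+ (+ 1) (+ j)) (ℚP.+-comm 1ℚ (fromℤ (+ j)))

    fromℤ-n-suc : ∀ n j → fromℤ (n ℤ.- + suc j) ≡ fromℤ n ℚ.- fromℤ (+ j) ℚ.- 1ℚ
    fromℤ-n-suc n j = begin
      fromℤ (n ℤ.- + suc j)            ≡⟨ cong fromℤ (ℤ-Solver.solve 2 (λ n j → n :- (con (+ 1) :+ j) := n :- j :- con (+ 1)) refl n (+ j)) ⟩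
      fromℤ (n ℤ.- + j ℤ.- + 1)        ≡⟨ fromℤ-sub (n ℤ.- + j) (+ 1) ⟩
      fromℤ (n ℤ.- + j) ℚ.- 1ℚ         ≡⟨ cong (ℚ._- 1ℚ) (fromℤ-sub n (+ j)) ⟩
      fromℤ n ℚ.- fromℤ (+ j) ℚ.- 1ℚ   ∎
      where
      open ≡-Reasoning
      open ℤ-Solver using (_:+_; _:-_; _:=_; con)

  binom-pascal : ∀ n j → binom (n ℤ.+ + 1) (suc j) ≡ binom n (suc j) ℚ.+ binom n j
  binom-pascal n zero = begin
    1ℚ ℚ.* fromℤ (n ℤ.+ + 1 ℤ.- + 0)          ≡⟨ cong (λ z → 1ℚ ℚ.* fromℤ z) reorder ⟩
    1ℚ ℚ.* fromℤ (n ℤ.- + 0 ℤ.+ + 1)          ≡⟨ cong (1ℚ ℚ.*_) (fromℤ-+ (n ℤ.- + 0) (+ 1)) ⟩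
    1ℚ ℚ.* (fromℤ (n ℤ.- + 0) ℚ.+ 1ℚ)          ≡⟨ ℚP.*-distribˡ-+ 1ℚ (fromℤ (n ℤ.- + 0)) 1ℚ ⟩
    1ℚ ℚ.* fromℤ (n ℤ.- + 0) ℚ.+ 1ℚ ℚ.* 1ℚ     ∎
    where
    open ≡-Reasoning
    open ℤ-Solver using (_:+_; _:-_; _:=_; con)
    reorder : n ℤ.+ + 1 ℤ.- + 0 ≡ n ℤ.- + 0 ℤ.+ + 1
    reorder = ℤ-Solver.solve 1 (λ n → n :+ con (+ 1) :- con (+ 0) := n :- con (+ 0) :+ con (+ 1)) refl n
  binom-pascal n (suc j) = fromℤ-suc-cancel (suc j) (begin
    fromℤ (+ suc (suc j)) ℚ.* binom (n ℤ.+ + 1) (suc (suc j))   ≡⟨ suc-*-binom-suc (n ℤ.+ + 1) (suc j) ⟩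
    fromℤ (n ℤ.+ + 1 ℤ.- + suc j) ℚ.* binom (n ℤ.+ + 1) (suc j) ≡⟨ cong₂ ℚ._*_ n+1-[1+j] (binom-pascal n j) ⟩
    (a ℚ.- i) ℚ.* (c₁ ℚ.+ c₀)                                    ≡⟨ ℚP.*-distribˡ-+ (a ℚ.- i) c₁ c₀ ⟩
    (a ℚ.- i) ℚ.* c₁ ℚ.+ (a ℚ.- i) ℚ.* c₀                        ≡⟨ cong ((a ℚ.- i) ℚ.* c₁ ℚ.+_) step₀ ⟨
    (a ℚ.- i) ℚ.* c₁ ℚ.+ (i ℚ.+ 1ℚ) ℚ.* c₁                       ≡⟨ shift ⟩
    (a ℚ.- i ℚ.- 1ℚ) ℚ.* c₁ ℚ.+ (i ℚ.+ 1ℚ ℚ.+ 1ℚ) ℚ.* c₁         ≡⟨ cong (ℚ._+ (i ℚ.+ 1ℚ ℚ.+ 1ℚ) ℚ.* c₁) step₁ ⟨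
    (i ℚ.+ 1ℚ ℚ.+ 1ℚ) ℚ.* c₂ ℚ.+ (i ℚ.+ 1ℚ ℚ.+ 1ℚ) ℚ.* c₁        ≡⟨ ℚP.*-distribˡ-+ (i ℚ.+ 1ℚ ℚ.+ 1ℚ) c₂ c₁ ⟨
    (i ℚ.+ 1ℚ ℚ.+ 1ℚ) ℚ.* (c₂ ℚ.+ c₁)                           ≡⟨ cong (ℚ._* (c₂ ℚ.+ c₁)) 2+j ⟨
    fromℤ (+ suc (suc j)) ℚ.* (c₂ ℚ.+ c₁)                        ∎)
    where
    open ≡-Reasoning
    open ℚ-Solver using (_:+_; _:-_; _:*_; _:=_; con)
    a = fromℤ n
    i = fromℤ (+ j)
    c₀ = binom n j
    c₁ = binom n (suc j)
    c₂ = binom n (suc (suc j))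
    2+j : fromℤ (+ suc (suc j)) ≡ i ℚ.+ 1ℚ ℚ.+ 1ℚ
    2+j = trans (fromℤ-suc (suc j)) (cong (ℚ._+ 1ℚ) (fromℤ-suc j))
    n+1-[1+j] : fromℤ (n ℤ.+ + 1 ℤ.- + suc j) ≡ a ℚ.- i
    n+1-[1+j] = trans (cong fromℤ (ℤ-Solver.solve 2 (λ n j → n ℤS.:+ ℤS.con (+ 1) ℤS.:- (ℤS.con (+ 1) ℤS.:+ j) ℤS.:= n ℤS.:- j) refl n (+ j))) (fromℤ-sub n (+ j))
      where module ℤS = ℤ-Solver
    shift : (a ℚ.- i) ℚ.* c₁ ℚ.+ (i ℚ.+ 1ℚ) ℚ.* c₁ ≡ (a ℚ.- i ℚ.- 1ℚ) ℚ.* c₁ ℚ.+ (i ℚ.+ 1ℚ ℚ.+ 1ℚ) ℚ.* c₁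
    shift = ℚ-Solver.solve 3 (λ a i c₁ → (a :- i) :* c₁ :+ (i :+ con 1ℚ) :* c₁ := (a :- i :- con 1ℚ) :* c₁ :+ (i :+ con 1ℚ :+ con 1ℚ) :* c₁)
              refl a i c₁
    step₀ : (i ℚ.+ 1ℚ) ℚ.* c₁ ≡ (a ℚ.- i) ℚ.* c₀
    step₀ = trans (cong (ℚ._* c₁) (sym (fromℤ-suc j))) (trans (suc-*-binom-suc n j) (cong (ℚ._* c₀) (fromℤ-sub n (+ j))))
    step₁ : (i ℚ.+ 1ℚ ℚ.+ 1ℚ) ℚ.* c₂ ≡ (a ℚ.- i ℚ.- 1ℚ) ℚ.* c₁
    step₁ = trans (cong (ℚ._* c₂) (sym 2+j)) (trans (suc-*-binom-suc n (suc j)) (cong (ℚ._* c₁) (fromℤ-n-suc n j)))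

  binom-diagonal-suc : ∀ n → binom (+ n) (suc n) ≡ 0ℚ
  binom-diagonal-suc n = begin
    binom (+ n) n ℚ.* ((+ n ℤ.- + n) ℚ./ suc n)   ≡⟨ cong (λ z → binom (+ n) n ℚ.* (z ℚ./ suc n)) (ℤP.+-inverseʳ (+ n)) ⟩
    binom (+ n) n ℚ.* (+ 0 ℚ./ suc n)             ≡⟨ cong (binom (+ n) n ℚ.*_) (ℚP.0/n≡0 (suc n)) ⟩
    binom (+ n) n ℚ.* 0ℚ                          ≡⟨ ℚP.*-zeroʳ (binom (+ n) n) ⟩
    0ℚ                                            ∎
    where open ≡-Reasoning

  binom-vanishes : ∀ n i → n ℕ.< i → binom (+ n) i ≡ 0ℚ
  binom-vanishes n (suc i) (ℕ.s≤s n≤i) with ℕP.m≤n⇒m<n∨m≡n n≤i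
  ... | inj₁ n<i  = trans (cong (ℚ._* q) (binom-vanishes n i n<i)) (ℚP.*-zeroˡ q)
    where q = (+ n ℤ.- + i) ℚ./ suc i
  ... | inj₂ refl = binom-diagonal-suc n

module FPolynomials where

  open import Defs
  open Polynomials
  open Binomials
  open import Data.Nat using (ℕ; zero; suc; _∸_; _<_; _≤_; s≤s; z≤n)
  import Data.Nat.Properties as ℕP
  open import Data.Integer as ℤ using (ℤ; +_)
  open import Data.Integer.Solver using () renaming (module +-*-Solver to ℤ-Solver)
  open import Data.Rational as ℚ using (ℚ; 0ℚ; 1ℚ)
  import Data.Rational.Properties as ℚP
  open import Data.List using (List; []; _∷_; map; upTo; _++_; [_])
  import Data.List.Properties as List
  open import Function using (_∘_)
  open import Relation.Binary.PropositionalEquality hiding ([_])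
  open import Relation.Nullary using (yes; no)
  open import Tactic.RingSolver using (solve-∀)

  m∸n≡1+m∸[1+n] : ∀ {m n} → n < m → m ∸ n ≡ suc (m ∸ suc n)
  m∸n≡1+m∸[1+n] (s≤s n≤m-1) = ℕP.+-∸-assoc 1 n≤m-1

  private
    ∸-comm : ∀ m n o → m ∸ n ∸ o ≡ m ∸ o ∸ n
    ∸-comm m n o = trans (ℕP.∸-+-assoc m n o) (trans (cong (m ∸_) (ℕP.+-comm n o)) (sym (ℕP.∸-+-assoc m o n)))

  ∑ : ℕ → (ℕ → Poly) → Poly
  ∑ n F = polySum (map F (upTo n))

  ∑-suc : ∀ n F → ∑ (suc n) F ≡ polyAdd (F 0) (∑ n (F ∘ suc))
  ∑-suc n F = cong (λ xs → polyAdd (F 0) (polySum xs))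
    (trans (List.map-applyUpTo suc F n) (sym (List.map-applyUpTo (λ j → j) (F ∘ suc) n)))

  polySum-++ : ∀ ps qs → polySum (ps ++ qs) ≈ₚ polyAdd (polySum ps) (polySum qs)
  polySum-++ []       qs = ≈ₚ-refl
  polySum-++ (p ∷ ps) qs = ≈ₚ-trans (polyAdd-congˡ p (polySum-++ ps qs)) (≈ₚ-sym (polyAdd-assoc p (polySum ps) (polySum qs)))

  ∑-sucʳ : ∀ n F → ∑ (suc n) F ≈ₚ polyAdd (∑ n F) (F n)
  ∑-sucʳ n F = begin
    polySum (map F (upTo (suc n)))         ≡⟨ cong (polySum ∘ map F) (List.upTo-∷ʳ n) ⟨
    polySum (map F (upTo n ++ [ n ]))      ≡⟨ cong polySum (List.map-++ F (upTo n) [ n ]) ⟩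
    polySum (map F (upTo n) ++ [ F n ])    ≈⟨ polySum-++ (map F (upTo n)) [ F n ] ⟩
    polyAdd (∑ n F) (polyAdd (F n) [])     ≈⟨ polyAdd-congˡ (∑ n F) (polyAdd-identityʳ (F n)) ⟩
    polyAdd (∑ n F) (F n)                  ∎
    where open ≈ₚ-Reasoning

  ∑-cong : ∀ n {F G} → (∀ j → j < n → F j ≈ₚ G j) → ∑ n F ≈ₚ ∑ n G
  ∑-cong zero    F≈G = ≈ₚ-refl
  ∑-cong (suc n) {F} {G} F≈G = begin
    ∑ (suc n) F                      ≡⟨ ∑-suc n F ⟩
    polyAdd (F 0) (∑ n (F ∘ suc))    ≈⟨ polyAdd-cong (F≈G 0 (s≤s z≤n)) (∑-cong n (λ j j<n → F≈G (suc j) (s≤s j<n))) ⟩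
    polyAdd (G 0) (∑ n (G ∘ suc))    ≡⟨ ∑-suc n G ⟨
    ∑ (suc n) G                      ∎
    where open ≈ₚ-Reasoning

  ∑-polyAdd : ∀ n F G → ∑ n (λ j → polyAdd (F j) (G j)) ≈ₚ polyAdd (∑ n F) (∑ n G)
  ∑-polyAdd zero    F G = ≈ₚ-refl
  ∑-polyAdd (suc n) F G = begin
    ∑ (suc n) (λ j → polyAdd (F j) (G j))                                   ≡⟨ ∑-suc n _ ⟩
    polyAdd (polyAdd (F 0) (G 0)) (∑ n (λ j → polyAdd (F (suc j)) (G (suc j))))
      ≈⟨ polyAdd-congˡ (polyAdd (F 0) (G 0)) (∑-polyAdd n (F ∘ suc) (G ∘ suc)) ⟩
    polyAdd (polyAdd (F 0) (G 0)) (polyAdd (∑ n (F ∘ suc)) (∑ n (G ∘ suc)))  ≈⟨ polyAdd-middleFour (F 0) (G 0) _ _ ⟩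
    polyAdd (polyAdd (F 0) (∑ n (F ∘ suc))) (polyAdd (G 0) (∑ n (G ∘ suc)))  ≡⟨ cong₂ polyAdd (∑-suc n F) (∑-suc n G) ⟨
    polyAdd (∑ (suc n) F) (∑ (suc n) G)                                     ∎
    where open ≈ₚ-Reasoning

  ∑-polyMul : ∀ n c F → ∑ n (λ j → polyMul c (F j)) ≈ₚ polyMul c (∑ n F)
  ∑-polyMul zero    c F = ≈ₚ-sym (polyMul-zeroʳ c)
  ∑-polyMul (suc n) c F = begin
    ∑ (suc n) (λ j → polyMul c (F j))                           ≡⟨ ∑-suc n _ ⟩
    polyAdd (polyMul c (F 0)) (∑ n (λ j → polyMul c (F (suc j)))) ≈⟨ polyAdd-congˡ (polyMul c (F 0)) (∑-polyMul n c (F ∘ suc)) ⟩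
    polyAdd (polyMul c (F 0)) (polyMul c (∑ n (F ∘ suc)))       ≈⟨ polyMul-distribˡ c (F 0) _ ⟨
    polyMul c (polyAdd (F 0) (∑ n (F ∘ suc)))                   ≡⟨ cong (polyMul c) (∑-suc n F) ⟨
    polyMul c (∑ (suc n) F)                                     ∎
    where open ≈ₚ-Reasoning

  monomial : ℚ → ℕ → ℕ → Poly
  monomial c j e = polyMul (polyConst c) (polyMul (polyPow tPoly j) (polyPow oneMinusT e))

  monomial-+ : ∀ a b j e → monomial (a ℚ.+ b) j e ≈ₚ polyAdd (monomial a j e) (monomial b j e)
  monomial-+ a b j e = polyMul-distribʳ _ (polyConst a) (polyConst b)

  monomial-zero : ∀ {c} j e → c ≡ 0ℚ → monomial c j e ≈ₚ []
  monomial-zero j e refl = polyMul-congʳ _ (0∷-cong-[] ≈ₚ-refl)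

  monomial-sucˡ : ∀ c j e → monomial c (suc j) e ≈ₚ polyMul tPoly (monomial c j e)
  monomial-sucˡ c j e = lemma (polyConst c) tPoly (polyPow tPoly j) (polyPow oneMinusT e)
    where
    lemma : ∀ a b c d → polyMul a (polyMul (polyMul b c) d) ≈ₚ polyMul b (polyMul a (polyMul c d))
    lemma = solve-∀ polyAlmostCommutativeRing

  monomial-sucʳ : ∀ c j e → monomial c j (suc e) ≈ₚ polyMul oneMinusT (monomial c j e)
  monomial-sucʳ c j e = lemma (polyConst c) (polyPow tPoly j) oneMinusT (polyPow oneMinusT e)
    where
    lemma : ∀ a b c d → polyMul a (polyMul b (polyMul c d)) ≈ₚ polyMul c (polyMul a (polyMul b d))
    lemma = solve-∀ polyAlmostCommutativeRing

  fTerm : ℕ → ℤ → ℕ → ℕ → Poly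
  fTerm i k e j = monomial (binom (+ (e ∸ j)) i ℚ.* binom (k ℤ.+ + e ℤ.- + i ℤ.- + 2) j) j (e ∸ i ∸ j)

  oneMinusT+t : polyAdd oneMinusT tPoly ≈ₚ polyOne
  oneMinusT+t = mk≈ₚ λ { zero → refl ; (suc zero) → refl ; (suc (suc d)) → refl }

  bernstein : ℕ → ℕ → Poly
  bernstein n j = monomial (binom (+ n) j) j (n ∸ j)

  private
    bernstein-suc-suc : ∀ n j → bernstein (suc n) (suc j) ≈ₚ polyAdd (monomial (binom (+ n) (suc j)) (suc j) (n ∸ j)) (polyMul tPoly (bernstein n j))
    bernstein-suc-suc n j = begin
      monomial (binom (+ suc n) (suc j)) (suc j) (n ∸ j)
        ≡⟨ cong (λ z → monomial (binom z (suc j)) (suc j) (n ∸ j)) (cong +_ (ℕP.+-comm 1 n)) ⟩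
      monomial (binom (+ n ℤ.+ + 1) (suc j)) (suc j) (n ∸ j)
        ≡⟨ cong (λ c → monomial c (suc j) (n ∸ j)) (binom-pascal (+ n) j) ⟩
      monomial (binom (+ n) (suc j) ℚ.+ binom (+ n) j) (suc j) (n ∸ j)
        ≈⟨ monomial-+ (binom (+ n) (suc j)) (binom (+ n) j) (suc j) (n ∸ j) ⟩
      polyAdd (monomial (binom (+ n) (suc j)) (suc j) (n ∸ j)) (monomial (binom (+ n) j) (suc j) (n ∸ j))
        ≈⟨ polyAdd-congˡ (monomial (binom (+ n) (suc j)) (suc j) (n ∸ j)) (monomial-sucˡ (binom (+ n) j) j (n ∸ j)) ⟩
      polyAdd (monomial (binom (+ n) (suc j)) (suc j) (n ∸ j)) (polyMul tPoly (bernstein n j)) ∎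
      where open ≈ₚ-Reasoning

    oneMinusT*bernsteinSum : ∀ n → polyMul oneMinusT (∑ (suc n) (bernstein n))
      ≈ₚ polyAdd (bernstein (suc n) 0) (∑ (suc n) (λ j → monomial (binom (+ n) (suc j)) (suc j) (n ∸ j)))
    oneMinusT*bernsteinSum n = begin
      polyMul oneMinusT (∑ (suc n) (bernstein n))
        ≈⟨ ∑-polyMul (suc n) oneMinusT (bernstein n) ⟨
      ∑ (suc n) (λ j → polyMul oneMinusT (bernstein n j))
        ≈⟨ ∑-cong (suc n) (λ j _ → monomial-sucʳ (binom (+ n) j) j (n ∸ j)) ⟨
      ∑ (suc n) (λ j → monomial (binom (+ n) j) j (suc (n ∸ j)))
        ≡⟨ ∑-suc n (λ j → monomial (binom (+ n) j) j (suc (n ∸ j))) ⟩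
      polyAdd (bernstein (suc n) 0) (∑ n (λ j → monomial (binom (+ n) (suc j)) (suc j) (suc (n ∸ suc j))))
        ≈⟨ polyAdd-congˡ (bernstein (suc n) 0) (∑-cong n λ j j<n → ≡⇒≈ₚ (cong (monomial (binom (+ n) (suc j)) (suc j)) (sym (m∸n≡1+m∸[1+n] j<n)))) ⟩
      polyAdd (bernstein (suc n) 0) (∑ n (λ j → monomial (binom (+ n) (suc j)) (suc j) (n ∸ j)))
        ≈⟨ polyAdd-congˡ (bernstein (suc n) 0) (≈ₚ-sym (≈ₚ-trans (∑-sucʳ n H) (≈ₚ-trans (polyAdd-congˡ (∑ n H) lastVanishes) (polyAdd-identityʳ (∑ n H))))) ⟩
      polyAdd (bernstein (suc n) 0) (∑ (suc n) (λ j → monomial (binom (+ n) (suc j)) (suc j) (n ∸ j))) ∎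
      where
      open ≈ₚ-Reasoning
      H = λ j → monomial (binom (+ n) (suc j)) (suc j) (n ∸ j)
      lastVanishes : monomial (binom (+ n) (suc n)) (suc n) (n ∸ n) ≈ₚ []
      lastVanishes = monomial-zero (suc n) (n ∸ n) (binom-diagonal-suc n)

  binomial-theorem : ∀ n → ∑ (suc n) (bernstein n) ≈ₚ polyOne
  binomial-theorem zero    = ≈ₚ-trans (polyAdd-identityʳ (bernstein 0 0)) (polyMul-identityʳ (polyConst 1ℚ))
  binomial-theorem (suc n) = begin
    ∑ (suc (suc n)) (bernstein (suc n))
      ≡⟨ ∑-suc (suc n) (bernstein (suc n)) ⟩
    polyAdd (bernstein (suc n) 0) (∑ (suc n) (λ j → bernstein (suc n) (suc j)))
      ≈⟨ polyAdd-congˡ (bernstein (suc n) 0) (≈ₚ-trans (∑-cong (suc n) (λ j _ → bernstein-suc-suc n j)) (∑-polyAdd (suc n) H (λ j → polyMul tPoly (bernstein n j)))) ⟩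
    polyAdd (bernstein (suc n) 0) (polyAdd (∑ (suc n) H) (∑ (suc n) (λ j → polyMul tPoly (bernstein n j))))
      ≈⟨ polyAdd-assoc (bernstein (suc n) 0) (∑ (suc n) H) (∑ (suc n) (λ j → polyMul tPoly (bernstein n j))) ⟨
    polyAdd (polyAdd (bernstein (suc n) 0) (∑ (suc n) H)) (∑ (suc n) (λ j → polyMul tPoly (bernstein n j)))
      ≈⟨ polyAdd-cong (≈ₚ-sym (oneMinusT*bernsteinSum n)) (∑-polyMul (suc n) tPoly (bernstein n)) ⟩
    polyAdd (polyMul oneMinusT B) (polyMul tPoly B)
      ≈⟨ polyMul-distribʳ B oneMinusT tPoly ⟨
    polyMul (polyAdd oneMinusT tPoly) B
      ≈⟨ polyMul-congʳ B oneMinusT+t ⟩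
    polyMul polyOne B
      ≈⟨ polyMul-identityˡ B ⟩
    B
      ≈⟨ binomial-theorem n ⟩
    polyOne ∎
    where
    open ≈ₚ-Reasoning
    B = ∑ (suc n) (bernstein n)
    H = λ j → monomial (binom (+ n) (suc j)) (suc j) (n ∸ j)

  private
    fTerm-0 : ∀ k e j → fTerm 0 k e j ≡ monomial (binom (k ℤ.+ + e ℤ.- + 0 ℤ.- + 2) j) j (e ∸ j)
    fTerm-0 k e j = cong (λ c → monomial c j (e ∸ j)) (ℚP.*-identityˡ (binom (k ℤ.+ + e ℤ.- + 0 ℤ.- + 2) j))

  fPoly-0-zero : ∀ k → fPoly 0 k 0 ≈ₚ polyOne
  fPoly-0-zero k = begin
    polyAdd (fTerm 0 k 0 0) []       ≈⟨ polyAdd-identityʳ (fTerm 0 k 0 0) ⟩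
    fTerm 0 k 0 0                    ≡⟨ fTerm-0 k 0 0 ⟩
    polyMul polyOne (polyMul polyOne polyOne) ≈⟨ polyMul-identityˡ (polyMul polyOne polyOne) ⟩
    polyMul polyOne polyOne          ≈⟨ polyMul-identityˡ polyOne ⟩
    polyOne                          ∎
    where open ≈ₚ-Reasoning

  fPoly-suc-zero : ∀ i k → fPoly (suc i) k 0 ≈ₚ []
  fPoly-suc-zero i k = ≈ₚ-trans (polyAdd-identityʳ (fTerm (suc i) k 0 0))
    (monomial-zero 0 0 (trans (cong (ℚ._* c) (binom-vanishes 0 (suc i) (s≤s z≤n))) (ℚP.*-zeroˡ c)))
    where c = binom (k ℤ.+ + 0 ℤ.- + suc i ℤ.- + 2) 0

  fPoly-0-2 : ∀ e → fPoly 0 (+ 2) e ≈ₚ polyOne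
  fPoly-0-2 e = ≈ₚ-trans (∑-cong (suc e) λ j _ → ≡⇒≈ₚ (trans (fTerm-0 (+ 2) e j) (cong (λ z → monomial (binom z j) j (e ∸ j)) top≡e)))
                         (binomial-theorem e)
    where
    open ℤ-Solver using (_:+_; _:-_; _:=_; con)
    top≡e : + 2 ℤ.+ + e ℤ.- + 0 ℤ.- + 2 ≡ + e
    top≡e = ℤ-Solver.solve 1 (λ e → con (+ 2) :+ e :- con (+ 0) :- con (+ 2) := e) refl (+ e)

  fPoly-0-1-suc : ∀ e → fPoly 0 (+ 1) (suc e) ≈ₚ oneMinusT
  fPoly-0-1-suc e = begin
    ∑ (suc (suc e)) (fTerm 0 (+ 1) (suc e))
      ≈⟨ ∑-sucʳ (suc e) (fTerm 0 (+ 1) (suc e)) ⟩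
    polyAdd (∑ (suc e) (fTerm 0 (+ 1) (suc e))) (fTerm 0 (+ 1) (suc e) (suc e))
      ≈⟨ polyAdd-cong (∑-cong (suc e) earlier) lastVanishes ⟩
    polyAdd (∑ (suc e) (λ j → polyMul oneMinusT (bernstein e j))) []
      ≈⟨ polyAdd-identityʳ (∑ (suc e) (λ j → polyMul oneMinusT (bernstein e j))) ⟩
    ∑ (suc e) (λ j → polyMul oneMinusT (bernstein e j))
      ≈⟨ ∑-polyMul (suc e) oneMinusT (bernstein e) ⟩
    polyMul oneMinusT (∑ (suc e) (bernstein e))
      ≈⟨ polyMul-congˡ oneMinusT (binomial-theorem e) ⟩
    polyMul oneMinusT polyOne
      ≈⟨ polyMul-identityʳ oneMinusT ⟩
    oneMinusT ∎
    where
    open ≈ₚ-Reasoning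
    open ℤ-Solver using (_:+_; _:-_; _:=_; con)
    top≡e : + 1 ℤ.+ + suc e ℤ.- + 0 ℤ.- + 2 ≡ + e
    top≡e = ℤ-Solver.solve 1 (λ e → con (+ 1) :+ (con (+ 1) :+ e) :- con (+ 0) :- con (+ 2) := e) refl (+ e)
    earlier : ∀ j → j < suc e → fTerm 0 (+ 1) (suc e) j ≈ₚ polyMul oneMinusT (bernstein e j)
    earlier j (s≤s j≤e) = begin
      fTerm 0 (+ 1) (suc e) j                    ≡⟨ fTerm-0 (+ 1) (suc e) j ⟩
      monomial (binom (+ 1 ℤ.+ + suc e ℤ.- + 0 ℤ.- + 2) j) j (suc e ∸ j) ≡⟨ cong₂ (λ z x → monomial (binom z j) j x) top≡e (ℕP.+-∸-assoc 1 j≤e) ⟩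
      monomial (binom (+ e) j) j (suc (e ∸ j))   ≈⟨ monomial-sucʳ (binom (+ e) j) j (e ∸ j) ⟩
      polyMul oneMinusT (bernstein e j)          ∎
    lastVanishes : fTerm 0 (+ 1) (suc e) (suc e) ≈ₚ []
    lastVanishes = monomial-zero (suc e) (suc e ∸ suc e)
      (trans (ℚP.*-identityˡ (binom (+ 1 ℤ.+ + suc e ℤ.- + 0 ℤ.- + 2) (suc e)))
             (trans (cong (λ z → binom z (suc e)) top≡e) (binom-diagonal-suc e)))

  private
    module Recurrence (i : ℕ) (k : ℤ) (e : ℕ) where
      open ℤ-Solver using (_:+_; _:-_; _:=_; con)

      N : ℤ
      N = k ℤ.+ + suc e ℤ.- + i ℤ.- + 2

      -- Pascal's rule in the second binomial gives f_i(k + 1, e + 1) = f_i(k, e + 1) + ∑ R, in the first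
      -- one L = R + M; and t f_{i+1}(k + 1, e + 1) = ∑ L, t(1 − t) f_{i+1}(k + 2, e) = ∑ M.
      R L M : ℕ → Poly
      R j = monomial (binom (+ (e ∸ j)) i ℚ.* binom N j) (suc j) (suc e ∸ i ∸ suc j)
      L j = polyMul tPoly (monomial (binom (+ (suc e ∸ j)) (suc i) ℚ.* binom N j) j (e ∸ i ∸ j))
      M j = polyMul tPoly (polyMul oneMinusT (monomial (binom (+ (e ∸ j)) (suc i) ℚ.* binom N j) j (e ∸ suc i ∸ j)))

      f[k+1]≈f[k]+∑R : fPoly i (ℤ.suc k) (suc e) ≈ₚ polyAdd (fPoly i k (suc e)) (∑ (suc e) R)
      f[k+1]≈f[k]+∑R = begin
        fPoly i (ℤ.suc k) (suc e)
          ≡⟨ ∑-suc (suc e) (fTerm i (ℤ.suc k) (suc e)) ⟩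
        polyAdd (fTerm i k (suc e) 0) (∑ (suc e) (fTerm i (ℤ.suc k) (suc e) ∘ suc))
          ≈⟨ polyAdd-congˡ (fTerm i k (suc e) 0) (∑-cong (suc e) λ j _ → pascal-term j) ⟩
        polyAdd (fTerm i k (suc e) 0) (∑ (suc e) λ j → polyAdd (fTerm i k (suc e) (suc j)) (R j))
          ≈⟨ polyAdd-congˡ (fTerm i k (suc e) 0) (∑-polyAdd (suc e) (fTerm i k (suc e) ∘ suc) R) ⟩
        polyAdd (fTerm i k (suc e) 0) (polyAdd (∑ (suc e) (fTerm i k (suc e) ∘ suc)) (∑ (suc e) R))
          ≈⟨ polyAdd-assoc (fTerm i k (suc e) 0) (∑ (suc e) (fTerm i k (suc e) ∘ suc)) (∑ (suc e) R) ⟨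
        polyAdd (polyAdd (fTerm i k (suc e) 0) (∑ (suc e) (fTerm i k (suc e) ∘ suc))) (∑ (suc e) R)
          ≡⟨ cong (λ p → polyAdd p (∑ (suc e) R)) (∑-suc (suc e) (fTerm i k (suc e))) ⟨
        polyAdd (fPoly i k (suc e)) (∑ (suc e) R) ∎
        where
        open ≈ₚ-Reasoning
        top : ℤ.suc k ℤ.+ + suc e ℤ.- + i ℤ.- + 2 ≡ N ℤ.+ + 1
        top = ℤ-Solver.solve 3 (λ k e i → con (+ 1) :+ k :+ e :- i :- con (+ 2) := k :+ e :- i :- con (+ 2) :+ con (+ 1)) refl k (+ suc e) (+ i)
        pascal-term : ∀ j → fTerm i (ℤ.suc k) (suc e) (suc j) ≈ₚ polyAdd (fTerm i k (suc e) (suc j)) (R j)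
        pascal-term j = begin
          monomial (b ℚ.* binom (ℤ.suc k ℤ.+ + suc e ℤ.- + i ℤ.- + 2) (suc j)) (suc j) x
            ≡⟨ cong (λ z → monomial (b ℚ.* z) (suc j) x) (trans (cong (λ z → binom z (suc j)) top) (binom-pascal N j)) ⟩
          monomial (b ℚ.* (binom N (suc j) ℚ.+ binom N j)) (suc j) x
            ≡⟨ cong (λ c → monomial c (suc j) x) (ℚP.*-distribˡ-+ b (binom N (suc j)) (binom N j)) ⟩
          monomial (b ℚ.* binom N (suc j) ℚ.+ b ℚ.* binom N j) (suc j) x
            ≈⟨ monomial-+ (b ℚ.* binom N (suc j)) (b ℚ.* binom N j) (suc j) x ⟩
          polyAdd (fTerm i k (suc e) (suc j)) (R j) ∎
          where
          b = binom (+ (e ∸ j)) i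
          x = suc e ∸ i ∸ suc j

      tf≈∑L : polyMul tPoly (fPoly (suc i) (ℤ.suc k) (suc e)) ≈ₚ ∑ (suc e) L
      tf≈∑L = begin
        polyMul tPoly (∑ (suc (suc e)) F)
          ≈⟨ polyMul-congˡ tPoly (∑-sucʳ (suc e) F) ⟩
        polyMul tPoly (polyAdd (∑ (suc e) F) (F (suc e)))
          ≈⟨ polyMul-congˡ tPoly (≈ₚ-trans (polyAdd-congˡ (∑ (suc e) F) lastVanishes) (polyAdd-identityʳ (∑ (suc e) F))) ⟩
        polyMul tPoly (∑ (suc e) F)
          ≈⟨ ∑-polyMul (suc e) tPoly F ⟨
        ∑ (suc e) (λ j → polyMul tPoly (F j))
          ≡⟨ cong (λ z → ∑ (suc e) (λ j → polyMul tPoly (monomial (binom (+ (suc e ∸ j)) (suc i) ℚ.* binom z j) j (e ∸ i ∸ j)))) top ⟩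
        ∑ (suc e) L ∎
        where
        open ≈ₚ-Reasoning
        F = fTerm (suc i) (ℤ.suc k) (suc e)
        top : ℤ.suc k ℤ.+ + suc e ℤ.- + suc i ℤ.- + 2 ≡ N
        top = ℤ-Solver.solve 3 (λ k e i → con (+ 1) :+ k :+ e :- (con (+ 1) :+ i) :- con (+ 2) := k :+ e :- i :- con (+ 2)) refl k (+ suc e) (+ i)
        lastVanishes : F (suc e) ≈ₚ []
        lastVanishes = monomial-zero (suc e) (e ∸ i ∸ suc e)
          (trans (cong (ℚ._* c) (trans (cong (λ n → binom (+ n) (suc i)) (ℕP.n∸n≡0 e)) (binom-vanishes 0 (suc i) (s≤s z≤n)))) (ℚP.*-zeroˡ c))
          where c = binom (ℤ.suc k ℤ.+ + suc e ℤ.- + suc i ℤ.- + 2) (suc e)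

      t[1-t]f≈∑M : polyMul tPoly (polyMul oneMinusT (fPoly (suc i) (ℤ.suc (ℤ.suc k)) e)) ≈ₚ ∑ (suc e) M
      t[1-t]f≈∑M = begin
        polyMul tPoly (polyMul oneMinusT (∑ (suc e) F))
          ≈⟨ polyMul-congˡ tPoly (∑-polyMul (suc e) oneMinusT F) ⟨
        polyMul tPoly (∑ (suc e) (λ j → polyMul oneMinusT (F j)))
          ≈⟨ ∑-polyMul (suc e) tPoly (λ j → polyMul oneMinusT (F j)) ⟨
        ∑ (suc e) (λ j → polyMul tPoly (polyMul oneMinusT (F j)))
          ≡⟨ cong (λ z → ∑ (suc e) (λ j → polyMul tPoly (polyMul oneMinusT (monomial (binom (+ (e ∸ j)) (suc i) ℚ.* binom z j) j (e ∸ suc i ∸ j))))) top ⟩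
        ∑ (suc e) M ∎
        where
        open ≈ₚ-Reasoning
        F = fTerm (suc i) (ℤ.suc (ℤ.suc k)) e
        top : ℤ.suc (ℤ.suc k) ℤ.+ + e ℤ.- + suc i ℤ.- + 2 ≡ N
        top = ℤ-Solver.solve 3 (λ k e i → con (+ 1) :+ (con (+ 1) :+ k) :+ e :- (con (+ 1) :+ i) :- con (+ 2) := k :+ (con (+ 1) :+ e) :- i :- con (+ 2)) refl k (+ e) (+ i)

      L≈R+M : ∀ j → j < suc e → L j ≈ₚ polyAdd (R j) (M j)
      L≈R+M j (s≤s j≤e) = begin
        polyMul tPoly (monomial (binom (+ (suc e ∸ j)) (suc i) ℚ.* C) j A)
          ≡⟨ cong (λ c → polyMul tPoly (monomial (c ℚ.* C) j A)) pascal ⟩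
        polyMul tPoly (monomial ((binom (+ a) (suc i) ℚ.+ binom (+ a) i) ℚ.* C) j A)
          ≡⟨ cong (λ c → polyMul tPoly (monomial c j A)) (ℚP.*-distribʳ-+ C (binom (+ a) (suc i)) (binom (+ a) i)) ⟩
        polyMul tPoly (monomial (c₁ ℚ.+ c₀) j A)
          ≈⟨ polyMul-congˡ tPoly (monomial-+ c₁ c₀ j A) ⟩
        polyMul tPoly (polyAdd (monomial c₁ j A) (monomial c₀ j A))
          ≈⟨ polyMul-distribˡ tPoly (monomial c₁ j A) (monomial c₀ j A) ⟩
        polyAdd (polyMul tPoly (monomial c₁ j A)) (polyMul tPoly (monomial c₀ j A))
          ≈⟨ polyAdd-comm (polyMul tPoly (monomial c₁ j A)) (polyMul tPoly (monomial c₀ j A)) ⟩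
        polyAdd (polyMul tPoly (monomial c₀ j A)) (polyMul tPoly (monomial c₁ j A))
          ≈⟨ polyAdd-cong R-part M-part ⟩
        polyAdd (R j) (M j) ∎
        where
        open ≈ₚ-Reasoning
        a = e ∸ j
        A = e ∸ i ∸ j
        C = binom N j
        c₀ = binom (+ a) i ℚ.* C
        c₁ = binom (+ a) (suc i) ℚ.* C
        pascal : binom (+ (suc e ∸ j)) (suc i) ≡ binom (+ a) (suc i) ℚ.+ binom (+ a) i
        pascal = trans (cong (λ n → binom (+ n) (suc i)) (trans (ℕP.+-∸-assoc 1 j≤e) (ℕP.+-comm 1 a))) (binom-pascal (+ a) i)
        R-part : polyMul tPoly (monomial c₀ j A) ≈ₚ R j
        R-part = ≈ₚ-trans (≈ₚ-sym (monomial-sucˡ c₀ j A)) (≡⇒≈ₚ (cong (monomial c₀ (suc j)) (sym exponent)))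
          where
          exponent : suc e ∸ i ∸ suc j ≡ A
          exponent = trans (ℕP.∸-+-assoc (suc e) i (suc j)) (trans (cong (suc e ∸_) (ℕP.+-suc i j)) (sym (ℕP.∸-+-assoc e i j)))
        M-part : polyMul tPoly (monomial c₁ j A) ≈ₚ M j
        M-part with suc i ℕP.≤? a
        ... | yes i<a = polyMul-congˡ tPoly (begin
              monomial c₁ j A                                   ≡⟨ cong (monomial c₁ j) exponent ⟩
              monomial c₁ j (suc (e ∸ suc i ∸ j))                ≈⟨ monomial-sucʳ c₁ j (e ∸ suc i ∸ j) ⟩
              polyMul oneMinusT (monomial c₁ j (e ∸ suc i ∸ j))  ∎)
          where
          exponent : A ≡ suc (e ∸ suc i ∸ j)
          exponent = trans (∸-comm e i j) (trans (m∸n≡1+m∸[1+n] i<a) (cong suc (∸-comm e j (suc i))))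
        ... | no  a≤i = begin
              polyMul tPoly (monomial c₁ j A)   ≈⟨ polyMul-congˡ tPoly (monomial-zero j A c₁≡0) ⟩
              polyMul tPoly []                  ≈⟨ polyMul-congˡ tPoly (≈ₚ-trans (polyMul-congˡ oneMinusT (monomial-zero j B c₁≡0)) (polyMul-zeroʳ oneMinusT)) ⟨
              M j                               ∎
          where
          B = e ∸ suc i ∸ j
          c₁≡0 : c₁ ≡ 0ℚ
          c₁≡0 = trans (cong (ℚ._* C) (binom-vanishes a (suc i) (ℕP.≰⇒> a≤i))) (ℚP.*-zeroˡ C)

      recurrence : polyAdd (fPoly i k (suc e)) (polyMul tPoly (fPoly (suc i) (ℤ.suc k) (suc e)))
                 ≈ₚ polyAdd (fPoly i (ℤ.suc k) (suc e)) (polyMul tPoly (polyMul oneMinusT (fPoly (suc i) (ℤ.suc (ℤ.suc k)) e)))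
      recurrence = begin
        polyAdd (fPoly i k (suc e)) (polyMul tPoly (fPoly (suc i) (ℤ.suc k) (suc e)))
          ≈⟨ polyAdd-congˡ (fPoly i k (suc e)) (≈ₚ-trans tf≈∑L (∑-cong (suc e) L≈R+M)) ⟩
        polyAdd (fPoly i k (suc e)) (∑ (suc e) (λ j → polyAdd (R j) (M j)))
          ≈⟨ polyAdd-congˡ (fPoly i k (suc e)) (∑-polyAdd (suc e) R M) ⟩
        polyAdd (fPoly i k (suc e)) (polyAdd (∑ (suc e) R) (∑ (suc e) M))
          ≈⟨ polyAdd-assoc (fPoly i k (suc e)) (∑ (suc e) R) (∑ (suc e) M) ⟨
        polyAdd (polyAdd (fPoly i k (suc e)) (∑ (suc e) R)) (∑ (suc e) M)
          ≈⟨ polyAdd-cong (≈ₚ-sym f[k+1]≈f[k]+∑R) (≈ₚ-sym t[1-t]f≈∑M) ⟩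
        polyAdd (fPoly i (ℤ.suc k) (suc e)) (polyMul tPoly (polyMul oneMinusT (fPoly (suc i) (ℤ.suc (ℤ.suc k)) e))) ∎
        where open ≈ₚ-Reasoning

  fPoly-recurrence : ∀ i k e →
    polyAdd (fPoly i k (suc e)) (polyMul tPoly (fPoly (suc i) (ℤ.suc k) (suc e)))
      ≈ₚ polyAdd (fPoly i (ℤ.suc k) (suc e)) (polyMul tPoly (polyMul oneMinusT (fPoly (suc i) (ℤ.suc (ℤ.suc k)) e)))
  fPoly-recurrence i k e = Recurrence.recurrence i k e

module Combinations where

  open import Defs
  open Polynomials
  import Data.Nat as ℕ
  import Data.Rational as ℚ
  open import Data.List using (List; []; _∷_; [_]; map; concatMap; _++_)
  import Data.List.Properties as List
  open import Data.List.Relation.Binary.Pointwise using (Pointwise; []; _∷_)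
  open import Data.List.Relation.Unary.All using (All; []; _∷_)
  open import Data.List.Properties using (≡-dec)
  open import Data.Product using (_×_; _,_)
  open import Relation.Binary.PropositionalEquality hiding ([_])
  open import Relation.Binary.Bundles using (Setoid)
  open import Relation.Binary.Structures using (IsEquivalence)
  import Relation.Binary.Reasoning.Setoid
  open import Relation.Nullary using (Dec; yes; no)
  open import Data.Empty using (⊥-elim)
  open import Algebra.Bundles using (CommutativeMonoid)

  coeffPoly : Comb → Index → Poly
  coeffPoly []             κ = []
  coeffPoly ((p , λ′) ∷ c) κ with ≡-dec ℕ._≟_ λ′ κ
  ... | yes _ = polyAdd p (coeffPoly c κ)
  ... | no  _ = coeffPoly c κ

  combCoeff-coeffPoly : ∀ c κ d → combCoeff c κ d ≡ polyCoeff (coeffPoly c κ) d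
  combCoeff-coeffPoly []             κ d = refl
  combCoeff-coeffPoly ((p , λ′) ∷ c) κ d with ≡-dec ℕ._≟_ λ′ κ
  ... | yes _ = trans (cong (polyCoeff p d ℚ.+_) (combCoeff-coeffPoly c κ d)) (sym (coeff-polyAdd p (coeffPoly c κ) d))
  ... | no  _ = combCoeff-coeffPoly c κ d

  infix 4 _≋_
  record _≋_ (a b : Comb) : Set where
    constructor mk≋
    field coeffPoly-≈ : ∀ κ → coeffPoly a κ ≈ₚ coeffPoly b κ
  open _≋_ public

  ≋-isEquivalence : IsEquivalence _≋_
  ≋-isEquivalence = record
    { refl  = mk≋ λ _ → ≈ₚ-refl
    ; sym   = λ a≋b → mk≋ λ κ → ≈ₚ-sym (coeffPoly-≈ a≋b κ)
    ; trans = λ a≋b b≋c → mk≋ λ κ → ≈ₚ-trans (coeffPoly-≈ a≋b κ) (coeffPoly-≈ b≋c κ)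
    }

  ≋-setoid : Setoid _ _
  ≋-setoid = record { isEquivalence = ≋-isEquivalence }

  open IsEquivalence ≋-isEquivalence public
    renaming (refl to ≋-refl; sym to ≋-sym; trans to ≋-trans; reflexive to ≡⇒≋)

  module ≋-Reasoning = Relation.Binary.Reasoning.Setoid ≋-setoid

  ≋⇒≈ᶜ : ∀ {a b} → a ≋ b → a ≈ᶜ b
  ≋⇒≈ᶜ {a} {b} a≋b κ d = trans (combCoeff-coeffPoly a κ d) (trans (coeff-≡ (coeffPoly-≈ a≋b κ) d) (sym (combCoeff-coeffPoly b κ d)))

  coeffPoly-++ : ∀ a b κ → coeffPoly (a ++ b) κ ≈ₚ polyAdd (coeffPoly a κ) (coeffPoly b κ)
  coeffPoly-++ []             b κ = ≈ₚ-refl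
  coeffPoly-++ ((p , λ′) ∷ a) b κ with ≡-dec ℕ._≟_ λ′ κ
  ... | yes _ = ≈ₚ-trans (polyAdd-congˡ p (coeffPoly-++ a b κ)) (≈ₚ-sym (polyAdd-assoc p (coeffPoly a κ) (coeffPoly b κ)))
  ... | no  _ = coeffPoly-++ a b κ

  ++-cong : ∀ {a a′ b b′} → a ≋ a′ → b ≋ b′ → (a ++ b) ≋ (a′ ++ b′)
  ++-cong {a} {a′} {b} {b′} a≋a′ b≋b′ = mk≋ λ κ → ≈ₚ-trans (coeffPoly-++ a b κ)
    (≈ₚ-trans (polyAdd-cong (coeffPoly-≈ a≋a′ κ) (coeffPoly-≈ b≋b′ κ)) (≈ₚ-sym (coeffPoly-++ a′ b′ κ)))

  ++-comm : ∀ a b → (a ++ b) ≋ (b ++ a)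
  ++-comm a b = mk≋ λ κ → ≈ₚ-trans (coeffPoly-++ a b κ)
    (≈ₚ-trans (polyAdd-comm (coeffPoly a κ) (coeffPoly b κ)) (≈ₚ-sym (coeffPoly-++ b a κ)))

  combCommutativeMonoid : CommutativeMonoid _ _
  combCommutativeMonoid = record
    { Carrier = Comb ; _≈_ = _≋_ ; _∙_ = _++_ ; ε = []
    ; isCommutativeMonoid = record
      { isMonoid = record
        { isSemigroup = record
          { isMagma = record { isEquivalence = ≋-isEquivalence ; ∙-cong = ++-cong }
          ; assoc = λ a b c → ≡⇒≋ (List.++-assoc a b c) }
        ; identity = (λ _ → ≋-refl) , λ a → ≡⇒≋ (List.++-identityʳ a) }
      ; comm = ++-comm } }

  coeffPoly-combScale : ∀ q a κ → coeffPoly (combScale q a) κ ≈ₚ polyMul q (coeffPoly a κ)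
  coeffPoly-combScale q []             κ = ≈ₚ-sym (polyMul-zeroʳ q)
  coeffPoly-combScale q ((p , λ′) ∷ a) κ with ≡-dec ℕ._≟_ λ′ κ
  ... | yes _ = ≈ₚ-trans (polyAdd-congˡ (polyMul q p) (coeffPoly-combScale q a κ)) (≈ₚ-sym (polyMul-distribˡ q p (coeffPoly a κ)))
  ... | no  _ = coeffPoly-combScale q a κ

  combScale-cong : ∀ q {a b} → a ≋ b → combScale q a ≋ combScale q b
  combScale-cong q {a} {b} a≋b = mk≋ λ κ → ≈ₚ-trans (coeffPoly-combScale q a κ)
    (≈ₚ-trans (polyMul-congˡ q (coeffPoly-≈ a≋b κ)) (≈ₚ-sym (coeffPoly-combScale q b κ)))

  -- termwise equality; unlike _≋_ it is evidently preserved by combUp and combRight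
  infix 4 _≈ₜ_
  _≈ₜ_ : Poly × Index → Poly × Index → Set
  (p , κ) ≈ₜ (q , λ′) = p ≈ₚ q × κ ≡ λ′

  Pointwise⇒≋ : ∀ {a b} → Pointwise _≈ₜ_ a b → a ≋ b
  Pointwise⇒≋ []                                          = ≋-refl
  Pointwise⇒≋ {(p , κ) ∷ a} {(q , .κ) ∷ b} ((p≈q , refl) ∷ a≈b) = mk≋ coeffs
    where
    coeffs : ∀ κ′ → coeffPoly ((p , κ) ∷ a) κ′ ≈ₚ coeffPoly ((q , κ) ∷ b) κ′
    coeffs κ′ with ≡-dec ℕ._≟_ κ κ′
    ... | yes _ = polyAdd-cong p≈q (coeffPoly-≈ (Pointwise⇒≋ a≈b) κ′)
    ... | no  _ = coeffPoly-≈ (Pointwise⇒≋ a≈b) κ′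

  map-≈ₜ : ∀ {A : Set} {F G : A → Poly × Index} (xs : List A) → (∀ x → F x ≈ₜ G x) → Pointwise _≈ₜ_ (map F xs) (map G xs)
  map-≈ₜ []       F≈G = []
  map-≈ₜ (x ∷ xs) F≈G = F≈G x ∷ map-≈ₜ xs F≈G

  map-≈ₜ-All : ∀ {A : Set} {F G : A → Poly × Index} {xs : List A} → All (λ x → F x ≈ₜ G x) xs → Pointwise _≈ₜ_ (map F xs) (map G xs)
  map-≈ₜ-All []           = []
  map-≈ₜ-All (F≈G ∷ F≈Gs) = F≈G ∷ map-≈ₜ-All F≈Gs

  ≈ₜ-sym : ∀ {x y} → x ≈ₜ y → y ≈ₜ x
  ≈ₜ-sym (p≈q , κ≡λ) = ≈ₚ-sym p≈q , sym κ≡λ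

  concatMap-≋ : ∀ {A : Set} {F G : A → Comb} (xs : List A) → (∀ x → F x ≋ G x) → concatMap F xs ≋ concatMap G xs
  concatMap-≋ []       F≋G = ≋-refl
  concatMap-≋ (x ∷ xs) F≋G = ++-cong (F≋G x) (concatMap-≋ xs F≋G)

  concatMap-≋-All : ∀ {A : Set} {P : A → Set} {F G : A → Comb} {xs : List A} →
    (∀ {x} → P x → F x ≋ G x) → All P xs → concatMap F xs ≋ concatMap G xs
  concatMap-≋-All F≋G []         = ≋-refl
  concatMap-≋-All F≋G (px ∷ pxs) = ++-cong (F≋G px) (concatMap-≋-All F≋G pxs)

  ++-concatMap : ∀ {A : Set} (F G : A → Comb) xs → (concatMap F xs ++ concatMap G xs) ≋ concatMap (λ x → F x ++ G x) xs
  ++-concatMap F G []       = ≋-refl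
  ++-concatMap F G (x ∷ xs) = ≋-trans (middleFour (F x) (concatMap F xs) (G x) (concatMap G xs)) (++-cong ≋-refl (++-concatMap F G xs))
    where
    open import Algebra.Solver.CommutativeMonoid combCommutativeMonoid using (solve; _⊕_; _⊜_)
    middleFour : ∀ a b c d → ((a ++ b) ++ (c ++ d)) ≋ ((a ++ c) ++ (b ++ d))
    middleFour = solve 4 (λ a b c d → (a ⊕ b) ⊕ (c ⊕ d) ⊜ (a ⊕ c) ⊕ (b ⊕ d)) ≋-refl

  coeffPoly-∷-≡ : ∀ p κ c → coeffPoly ((p , κ) ∷ c) κ ≡ polyAdd p (coeffPoly c κ)
  coeffPoly-∷-≡ p κ c with ≡-dec ℕ._≟_ κ κ
  ... | yes _  = refl
  ... | no κ≢κ = ⊥-elim (κ≢κ refl)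

  coeffPoly-∷-≢ : ∀ p {κ κ′} c → κ ≢ κ′ → coeffPoly ((p , κ) ∷ c) κ′ ≡ coeffPoly c κ′
  coeffPoly-∷-≢ p {κ} {κ′} c κ≢κ′ with ≡-dec ℕ._≟_ κ κ′
  ... | yes κ≡κ′ = ⊥-elim (κ≢κ′ κ≡κ′)
  ... | no  _    = refl

  singleton-≋ : ∀ κ p ps → p ≈ₚ polySum ps → [ (p , κ) ] ≋ map (_, κ) ps
  singleton-≋ κ p ps p≈∑ps = mk≋ λ κ′ → at κ′ (≡-dec ℕ._≟_ κ κ′)
    where
    at-κ : ∀ qs → coeffPoly (map (_, κ) qs) κ ≈ₚ polySum qs
    at-κ []       = ≈ₚ-refl
    at-κ (q ∷ qs) = ≈ₚ-trans (≡⇒≈ₚ (coeffPoly-∷-≡ q κ (map (_, κ) qs))) (polyAdd-congˡ q (at-κ qs))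
    off-κ : ∀ {κ′} qs → κ ≢ κ′ → coeffPoly (map (_, κ) qs) κ′ ≡ []
    off-κ []       _    = refl
    off-κ (q ∷ qs) κ≢κ′ = trans (coeffPoly-∷-≢ q (map (_, κ) qs) κ≢κ′) (off-κ qs κ≢κ′)
    at : ∀ κ′ → Dec (κ ≡ κ′) → coeffPoly [ (p , κ) ] κ′ ≈ₚ coeffPoly (map (_, κ) ps) κ′
    at .κ (yes refl) = ≈ₚ-trans (≡⇒≈ₚ (coeffPoly-∷-≡ p κ [])) (≈ₚ-trans (polyAdd-identityʳ p) (≈ₚ-trans p≈∑ps (≈ₚ-sym (at-κ ps))))
    at κ′ (no κ≢κ′)  = ≡⇒≈ₚ (trans (coeffPoly-∷-≢ p [] κ≢κ′) (sym (off-κ ps κ≢κ′)))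

module Splittings where

  open import Defs
  open Combinations
  open import Data.Nat using (ℕ; suc; _≤_; s≤s; z≤n)
  import Data.Nat.Properties as ℕP
  open import Data.List using (List; []; _∷_; map; concatMap; _++_; [_]; length)
  import Data.List.Properties as List
  open import Data.List.Relation.Unary.All using (All; []; _∷_)
  open import Data.List.Relation.Unary.All.Properties using (++⁺)
  open import Data.Product using (_×_; _,_)
  open import Relation.Binary.PropositionalEquality hiding ([_])
  open import Function using (_∘′_)
  open import Algebra.Solver.CommutativeMonoid combCommutativeMonoid using (solve; _⊕_; _⊜_; id)

  data NonEmpty {A : Set} : List A → Set where
    nonEmpty : ∀ {x xs} → NonEmpty (x ∷ xs)

  consSplits : ℕ → List Index → List (List Index)
  consSplits x []       = ((x ∷ []) ∷ []) ∷ []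
  consSplits x (b ∷ bs) = ((x ∷ []) ∷ b ∷ bs) ∷ ((x ∷ b) ∷ bs) ∷ []

  splits-∷ : ∀ x xs → splits (x ∷ xs) ≡ concatMap (consSplits x) (splits xs)
  splits-∷ x xs = List.concatMap-cong (λ { [] → refl ; (b ∷ bs) → refl }) (splits xs)

  SplittingShape : Index → List Index → Set
  SplittingShape k B = NonEmpty B × All NonEmpty B × length B ≤ length k

  concatMap-All : ∀ {A B : Set} {P : A → Set} {Q : B → Set} (f : A → List B) {xs : List A} →
    (∀ {a} → P a → All Q (f a)) → All P xs → All Q (concatMap f xs)
  concatMap-All f P⇒Q []         = []
  concatMap-All f P⇒Q (px ∷ pxs) = ++⁺ (P⇒Q px) (concatMap-All f P⇒Q pxs)

  splits-shape : ∀ x xs → All (SplittingShape (x ∷ xs)) (splits (x ∷ xs))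
  splits-shape x []       = (nonEmpty , nonEmpty ∷ [] , s≤s z≤n) ∷ []
  splits-shape x (y ∷ ys) = subst (All (SplittingShape (x ∷ y ∷ ys))) (sym (splits-∷ x (y ∷ ys)))
    (concatMap-All (consSplits x) extend (splits-shape y ys))
    where
    extend : ∀ {B} → SplittingShape (y ∷ ys) B → All (SplittingShape (x ∷ y ∷ ys)) (consSplits x B)
    extend {b ∷ bs} (nonEmpty , (nb ∷ nbs) , B≤) =
      (nonEmpty , nonEmpty ∷ nb ∷ nbs , s≤s B≤) ∷ (nonEmpty , nonEmpty ∷ nbs , ℕP.m≤n⇒m≤1+n B≤) ∷ []

  mapLast : (Index → Index) → List Index → List Index
  mapLast f []           = []
  mapLast f (b ∷ [])     = f b ∷ []
  mapLast f (b ∷ b′ ∷ B) = b ∷ mapLast f (b′ ∷ B)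

  mapLast-snoc : ∀ f C b → mapLast f (C ++ [ b ]) ≡ C ++ [ f b ]
  mapLast-snoc f []           b = refl
  mapLast-snoc f (c ∷ [])     b = refl
  mapLast-snoc f (c ∷ c′ ∷ C) b = cong (c ∷_) (mapLast-snoc f (c′ ∷ C) b)

  idxUp-snoc : ∀ xs y → idxUp (xs ++ [ y ]) ≡ xs ++ [ suc y ]
  idxUp-snoc []           y = refl
  idxUp-snoc (x ∷ [])     y = refl
  idxUp-snoc (x ∷ x′ ∷ xs) y = cong (x ∷_) (idxUp-snoc (x′ ∷ xs) y)

  length-idxUp : ∀ xs → length (idxUp xs) ≡ length xs
  length-idxUp []           = refl
  length-idxUp (x ∷ [])     = refl
  length-idxUp (x ∷ y ∷ xs) = cong suc (length-idxUp (y ∷ xs))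

  concatMap-[] : ∀ {A B : Set} (xs : List A) → concatMap {B = B} (λ _ → []) xs ≡ []
  concatMap-[] []       = refl
  concatMap-[] (x ∷ xs) = concatMap-[] xs

  concatMap-All-≡ : ∀ {A B : Set} {P : A → Set} {F G : A → List B} {xs} →
    (∀ {x} → P x → F x ≡ G x) → All P xs → concatMap F xs ≡ concatMap G xs
  concatMap-All-≡ F≡G []         = refl
  concatMap-All-≡ F≡G (px ∷ pxs) = cong₂ _++_ (F≡G px) (concatMap-All-≡ F≡G pxs)

  concatMap-concatMap : ∀ {A B C : Set} (F : B → List C) (G : A → List B) xs →
    concatMap F (concatMap G xs) ≡ concatMap (concatMap F ∘′ G) xs
  concatMap-concatMap F G []       = refl
  concatMap-concatMap F G (x ∷ xs) =
    trans (List.concatMap-++ F (G x) (concatMap G xs)) (cong (concatMap F (G x) ++_) (concatMap-concatMap F G xs))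

  splits-snoc : ∀ c x xs (F : List Index → Comb) →
    concatMap F (splits ((x ∷ xs) ++ [ c ])) ≋ concatMap (λ B → F (B ++ [ [ c ] ]) ++ F (mapLast (_++ [ c ]) B)) (splits (x ∷ xs))
  splits-snoc c x []       F = solve 2 (λ a b → a ⊕ (b ⊕ id) ⊜ (a ⊕ b) ⊕ id) ≋-refl
    (F ((x ∷ []) ∷ (c ∷ []) ∷ [])) (F ((x ∷ c ∷ []) ∷ []))
  splits-snoc c x (y ∷ ys) F = begin
    concatMap F (splits (x ∷ (y ∷ ys) ++ [ c ]))
      ≡⟨ trans (cong (concatMap F) (splits-∷ x ((y ∷ ys) ++ [ c ]))) (concatMap-concatMap F (consSplits x) (splits ((y ∷ ys) ++ [ c ]))) ⟩
    concatMap F′ (splits ((y ∷ ys) ++ [ c ]))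
      ≈⟨ splits-snoc c y ys F′ ⟩
    concatMap (λ B → F′ (B ++ [ [ c ] ]) ++ F′ (mapLast (_++ [ c ]) B)) (splits (y ∷ ys))
      ≈⟨ concatMap-≋-All regroup (splits-shape y ys) ⟩
    concatMap (concatMap G ∘′ consSplits x) (splits (y ∷ ys))
      ≡⟨ trans (cong (concatMap G) (splits-∷ x (y ∷ ys))) (concatMap-concatMap G (consSplits x) (splits (y ∷ ys))) ⟨
    concatMap G (splits (x ∷ y ∷ ys)) ∎
    where
    open ≋-Reasoning
    F′ G : List Index → Comb
    F′ B = concatMap F (consSplits x B)
    G  B = F (B ++ [ [ c ] ]) ++ F (mapLast (_++ [ c ]) B)
    swap : ∀ p q r s → ((p ++ (q ++ [])) ++ (r ++ (s ++ []))) ≋ ((p ++ r) ++ ((q ++ s) ++ []))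
    swap = solve 4 (λ p q r s → (p ⊕ (q ⊕ id)) ⊕ (r ⊕ (s ⊕ id)) ⊜ (p ⊕ r) ⊕ ((q ⊕ s) ⊕ id)) ≋-refl
    regroup : ∀ {B} → SplittingShape (y ∷ ys) B → (F′ (B ++ [ [ c ] ]) ++ F′ (mapLast (_++ [ c ]) B)) ≋ concatMap G (consSplits x B)
    regroup {b ∷ []}      _ = swap (F ((x ∷ []) ∷ b ∷ (c ∷ []) ∷ [])) (F ((x ∷ b) ∷ (c ∷ []) ∷ []))
                                   (F ((x ∷ []) ∷ (b ++ [ c ]) ∷ [])) (F ((x ∷ b ++ [ c ]) ∷ []))
    regroup {b ∷ b′ ∷ bs} _ = swap (F ((x ∷ []) ∷ b ∷ (b′ ∷ bs ++ [ [ c ] ]))) (F ((x ∷ b) ∷ (b′ ∷ bs ++ [ [ c ] ])))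
                                   (F ((x ∷ []) ∷ b ∷ mapLast (_++ [ c ]) (b′ ∷ bs))) (F ((x ∷ b) ∷ mapLast (_++ [ c ]) (b′ ∷ bs)))

  splits-idxUp : ∀ x xs → splits (idxUp (x ∷ xs)) ≡ map (mapLast idxUp) (splits (x ∷ xs))
  splits-idxUp x []       = refl
  splits-idxUp x (y ∷ ys) = begin
    splits (x ∷ idxUp (y ∷ ys))                                          ≡⟨ splits-∷ x (idxUp (y ∷ ys)) ⟩
    concatMap (consSplits x) (splits (idxUp (y ∷ ys)))                   ≡⟨ cong (concatMap (consSplits x)) (splits-idxUp y ys) ⟩
    concatMap (consSplits x) (map (mapLast idxUp) (splits (y ∷ ys)))     ≡⟨ List.concatMap-map (consSplits x) (mapLast idxUp) (splits (y ∷ ys)) ⟩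
    concatMap (consSplits x ∘′ mapLast idxUp) (splits (y ∷ ys))          ≡⟨ concatMap-All-≡ commute (splits-shape y ys) ⟩
    concatMap (map (mapLast idxUp) ∘′ consSplits x) (splits (y ∷ ys))    ≡⟨ List.map-concatMap (mapLast idxUp) (consSplits x) (splits (y ∷ ys)) ⟨
    map (mapLast idxUp) (concatMap (consSplits x) (splits (y ∷ ys)))     ≡⟨ cong (map (mapLast idxUp)) (splits-∷ x (y ∷ ys)) ⟨
    map (mapLast idxUp) (splits (x ∷ y ∷ ys))                            ∎
    where
    open ≡-Reasoning
    commute : ∀ {B} → SplittingShape (y ∷ ys) B → consSplits x (mapLast idxUp B) ≡ map (mapLast idxUp) (consSplits x B)
    commute {_ ∷ []}    (_ , nonEmpty ∷ [] , _) = refl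
    commute {_ ∷ _ ∷ _} _                      = refl

module Expansion where

  open import Defs
  open Polynomials
  open FPolynomials
  open Combinations
  open Splittings
  open import Data.Nat as ℕ using (ℕ; zero; suc; _∸_; _<_)
  import Data.Nat.Properties as ℕP
  open import Data.Integer using (+_)
  open import Data.Rational as ℚ using (1ℚ)
  open import Data.List using (List; []; _∷_; map; concat; concatMap; _++_; [_]; length; upTo)
  import Data.List.Properties as List
  open import Data.List.Relation.Binary.Pointwise as Pointwise using (Pointwise; []; _∷_)
  import Data.List.Relation.Unary.All as All
  open import Data.List.Relation.Unary.All.Properties using (all-upTo)
  open import Data.Nat.ListAction using (sum)
  import Data.Nat.ListAction.Properties as ListSum
  open import Tactic.RingSolver using (solve-∀)
  open import Data.Product using (_×_; _,_; proj₁; proj₂)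
  open import Function using (_∘_)
  open import Relation.Binary.PropositionalEquality hiding ([_])

  weakComps-suc : ∀ m l → weakComps m (suc l) ≡ concatMap (λ e → map (e ∷_) (weakComps (m ∸ e) l)) (upTo (suc m))
  weakComps-suc zero    l = refl
  weakComps-suc (suc m) l = refl

  weakComps-1 : ∀ m → weakComps m 1 ≡ [ [ m ] ]
  weakComps-1 m = begin
    weakComps m 1                                  ≡⟨ weakComps-suc m 0 ⟩
    concatMap F (upTo (suc m))                     ≡⟨ cong (concatMap F) (List.upTo-∷ʳ m) ⟨
    concatMap F (upTo m ++ [ m ])                  ≡⟨ List.concatMap-++ F (upTo m) [ m ] ⟩
    concatMap F (upTo m) ++ F m ++ []              ≡⟨ cong (_++ F m ++ []) (concatMap-All-≡ F≡[] (all-upTo m)) ⟩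
    concatMap (λ _ → []) (upTo m) ++ F m ++ []     ≡⟨ cong (_++ F m ++ []) (concatMap-[] (upTo m)) ⟩
    F m ++ []                                      ≡⟨ cong (λ n → map (m ∷_) (weakComps n 0) ++ []) (ℕP.n∸n≡0 m) ⟩
    [ [ m ] ]                                      ∎
    where
    open ≡-Reasoning
    F : ℕ → List (List ℕ)
    F e = map (e ∷_) (weakComps (m ∸ e) 0)
    F≡[] : ∀ {e} → e < m → F e ≡ []
    F≡[] {e} e<m rewrite m∸n≡1+m∸[1+n] e<m = refl

  weakComps-2 : ∀ m → weakComps m 2 ≡ map (λ e → e ∷ (m ∸ e) ∷ []) (upTo (suc m))
  weakComps-2 m = begin
    weakComps m 2                                                                   ≡⟨ weakComps-suc m 1 ⟩
    concatMap (λ e → map (e ∷_) (weakComps (m ∸ e) 1)) (upTo (suc m))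
      ≡⟨ List.concatMap-cong (λ e → cong (map (e ∷_)) (weakComps-1 (m ∸ e))) (upTo (suc m)) ⟩
    concatMap (λ e → [ e ∷ (m ∸ e) ∷ [] ]) (upTo (suc m))
      ≡⟨ trans (cong concat (List.map-∘ {g = [_]} {f = pair} (upTo (suc m)))) (List.concat-map-[_] (map pair (upTo (suc m)))) ⟩
    map (λ e → e ∷ (m ∸ e) ∷ []) (upTo (suc m))                                     ∎
    where
    open ≡-Reasoning
    pair : ℕ → List ℕ
    pair e = e ∷ (m ∸ e) ∷ []

  -- g weights a splitting of an index of depth r into l blocks by ρ^(r−l)
  ρ : Poly
  ρ = polyMul (polyConst (ℚ.- 1ℚ)) (polyMul tPoly oneMinusT)

  -- f_{|c|−1}(sum of k′ over c, e), where k′ adds 1 to the first entry: φ = 1 for the first block, 0 after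
  blockFactor : ℕ → Index → ℕ → Poly
  blockFactor φ c e = fPoly (length c ∸ 1) (+ (sum c ℕ.+ φ)) e

  -- the sum over compositions for the blocks D, with coefficients multiplied by Q and indices prefixed by π;
  -- Q and π absorb the blocks already peeled off
  blockTerms : ℕ → Poly → Index → List Index → ℕ → Comb
  blockTerms φ Q π D m = map (λ es → (polyMul Q (fProd φ D es) , π ++ blockIndex D es)) (weakComps m (length D))

  predBlockTerms : ℕ → Poly → Index → List Index → ℕ → Comb
  predBlockTerms φ Q π D zero    = []
  predBlockTerms φ Q π D (suc m) = blockTerms φ Q π D m

  blockTerms-[_] : ∀ φ Q π d m → blockTerms φ Q π [ d ] m ≡ [ (polyMul Q (polyMul (blockFactor φ d m) polyOne) , π ++ [ sum d ℕ.+ m ]) ]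
  blockTerms-[_] φ Q π d m = cong (map _) (weakComps-1 m)

  blockTerms-cong : ∀ φ {Q Q′} π D m → Q ≈ₚ Q′ → Pointwise _≈ₜ_ (blockTerms φ Q π D m) (blockTerms φ Q′ π D m)
  blockTerms-cong φ π D m Q≈Q′ = map-≈ₜ (weakComps m (length D)) (λ es → polyMul-congʳ (fProd φ D es) Q≈Q′ , refl)

  concatMap-Pointwise : ∀ {A : Set} {F G : A → Comb} (xs : List A) → (∀ x → Pointwise _≈ₜ_ (F x) (G x)) →
    Pointwise _≈ₜ_ (concatMap F xs) (concatMap G xs)
  concatMap-Pointwise []       F≈G = []
  concatMap-Pointwise (x ∷ xs) F≈G = Pointwise.++⁺ (F≈G x) (concatMap-Pointwise xs F≈G)

  blockTerms-∷ : ∀ φ Q π c D m → Pointwise _≈ₜ_ (blockTerms φ Q π (c ∷ D) m)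
    (concatMap (λ e → blockTerms 0 (polyMul Q (blockFactor φ c e)) (π ++ [ sum c ℕ.+ e ]) D (m ∸ e)) (upTo (suc m)))
  blockTerms-∷ φ Q π c D m = subst (λ ts → Pointwise _≈ₜ_ ts (concatMap peeled (upTo (suc m)))) (sym unfold)
    (concatMap-Pointwise (upTo (suc m)) λ e → map-≈ₜ (weakComps (m ∸ e) (length D)) λ es →
      ≈ₚ-sym (polyMul-assoc Q (blockFactor φ c e) (fProd 0 D es)) , sym (List.++-assoc π [ sum c ℕ.+ e ] (blockIndex D es)))
    where
    peeled : ℕ → Comb
    peeled e = blockTerms 0 (polyMul Q (blockFactor φ c e)) (π ++ [ sum c ℕ.+ e ]) D (m ∸ e)
    h : List ℕ → Poly × Index
    h es = (polyMul Q (fProd φ (c ∷ D) es) , π ++ blockIndex (c ∷ D) es)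
    unfold : blockTerms φ Q π (c ∷ D) m ≡ concatMap (λ e → map (h ∘ (e ∷_)) (weakComps (m ∸ e) (length D))) (upTo (suc m))
    unfold = begin
      map h (weakComps m (suc (length D)))
        ≡⟨ cong (map h) (weakComps-suc m (length D)) ⟩
      map h (concatMap (λ e → map (e ∷_) (weakComps (m ∸ e) (length D))) (upTo (suc m)))
        ≡⟨ List.map-concatMap h _ (upTo (suc m)) ⟩
      concatMap (λ e → map h (map (e ∷_) (weakComps (m ∸ e) (length D)))) (upTo (suc m))
        ≡⟨ List.concatMap-cong (λ e → sym (List.map-∘ (weakComps (m ∸ e) (length D)))) (upTo (suc m)) ⟩
      concatMap (λ e → map (h ∘ (e ∷_)) (weakComps (m ∸ e) (length D))) (upTo (suc m)) ∎
      where open ≡-Reasoning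

  predBlockTerms-cong : ∀ φ {Q Q′} π D m → Q ≈ₚ Q′ → predBlockTerms φ Q π D m ≋ predBlockTerms φ Q′ π D m
  predBlockTerms-cong φ π D zero    Q≈Q′ = ≋-refl
  predBlockTerms-cong φ π D (suc m) Q≈Q′ = Pointwise⇒≋ (blockTerms-cong φ π D m Q≈Q′)

  predBlockTerms-∷ : ∀ φ Q π c D m → predBlockTerms φ Q π (c ∷ D) m
    ≋ concatMap (λ e → predBlockTerms 0 (polyMul Q (blockFactor φ c e)) (π ++ [ sum c ℕ.+ e ]) D (m ∸ e)) (upTo (suc m))
  predBlockTerms-∷ φ Q π c D zero    = ≋-refl
  predBlockTerms-∷ φ Q π c D (suc m) = begin
    blockTerms φ Q π (c ∷ D) m                                      ≈⟨ Pointwise⇒≋ (blockTerms-∷ φ Q π c D m) ⟩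
    concatMap (λ e → P e (suc (m ∸ e))) (upTo (suc m))               ≡⟨ concatMap-All-≡ (λ e<1+m → cong (P _) (sym (m∸n≡1+m∸[1+n] e<1+m))) (all-upTo (suc m)) ⟩
    concatMap P′ (upTo (suc m))                                      ≡⟨ List.++-identityʳ _ ⟨
    concatMap P′ (upTo (suc m)) ++ []                                ≡⟨ cong (λ n → concatMap P′ (upTo (suc m)) ++ P (suc m) n ++ []) (ℕP.n∸n≡0 (suc m)) ⟨
    concatMap P′ (upTo (suc m)) ++ P′ (suc m) ++ []                  ≡⟨ List.concatMap-++ P′ (upTo (suc m)) [ suc m ] ⟨
    concatMap P′ (upTo (suc m) ++ [ suc m ])                         ≡⟨ cong (concatMap P′) (List.upTo-∷ʳ (suc m)) ⟩
    concatMap P′ (upTo (suc (suc m)))                                ∎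
    where
    open ≋-Reasoning
    P : ℕ → ℕ → Comb
    P e = predBlockTerms 0 (polyMul Q (blockFactor φ c e)) (π ++ [ sum c ℕ.+ e ]) D
    P′ : ℕ → Comb
    P′ e = P e (suc m ∸ e)

  recurrenceRhs : Comb → Comb → Comb → Comb
  recurrenceRhs T T↑ P =
    combAdd (combAdd (combAdd (combScale oneMinusT (combUp T)) (combRight T)) (combNeg (combScale oneMinusT T↑))) (combScale oneMinusT P)

  combUp-Pointwise : ∀ {a b} → Pointwise _≈ₜ_ a b → Pointwise _≈ₜ_ (combUp a) (combUp b)
  combUp-Pointwise []                  = []
  combUp-Pointwise ((p≈q , κ≡λ) ∷ a≈b) = (p≈q , cong idxUp κ≡λ) ∷ combUp-Pointwise a≈b

  combRight-Pointwise : ∀ {a b} → Pointwise _≈ₜ_ a b → Pointwise _≈ₜ_ (combRight a) (combRight b)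
  combRight-Pointwise []                  = []
  combRight-Pointwise ((p≈q , κ≡λ) ∷ a≈b) = (p≈q , cong idxRight κ≡λ) ∷ combRight-Pointwise a≈b

  recurrenceRhs-cong : ∀ {T T′ T↑ T↑′ P P′} → Pointwise _≈ₜ_ T T′ → T↑ ≋ T↑′ → P ≋ P′ → recurrenceRhs T T↑ P ≋ recurrenceRhs T′ T↑′ P′
  recurrenceRhs-cong T≈T′ T↑≋T↑′ P≋P′ =
    ++-cong (++-cong (++-cong (combScale-cong oneMinusT (Pointwise⇒≋ (combUp-Pointwise T≈T′))) (Pointwise⇒≋ (combRight-Pointwise T≈T′)))
                     (combScale-cong (polyConst (ℚ.- 1ℚ)) (combScale-cong oneMinusT T↑≋T↑′)))
            (combScale-cong oneMinusT P≋P′)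

  recurrenceRhs-congʳ : ∀ T T↑ {P P′} → P ≋ P′ → recurrenceRhs T T↑ P ≋ recurrenceRhs T T↑ P′
  recurrenceRhs-congʳ T T↑ P≋P′ = ++-cong ≋-refl (combScale-cong oneMinusT P≋P′)

  recurrenceRhs-concatMap : ∀ {A : Set} (T T↑ P : A → Comb) xs →
    recurrenceRhs (concatMap T xs) (concatMap T↑ xs) (concatMap P xs) ≋ concatMap (λ x → recurrenceRhs (T x) (T↑ x) (P x)) xs
  recurrenceRhs-concatMap T T↑ P xs = begin
    recurrenceRhs (concatMap T xs) (concatMap T↑ xs) (concatMap P xs)
      ≡⟨ cong₂ _++_ (cong₂ _++_ (cong₂ _++_ (trans (cong (combScale oneMinusT) (List.map-concatMap _ T xs)) (List.map-concatMap _ (combUp ∘ T) xs))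
                                             (List.map-concatMap _ T xs))
                                (trans (cong combNeg (List.map-concatMap _ T↑ xs)) (List.map-concatMap _ (combScale oneMinusT ∘ T↑) xs)))
                    (List.map-concatMap _ P xs) ⟩
    ((concatMap A xs ++ concatMap B xs) ++ concatMap C xs) ++ concatMap D xs
      ≈⟨ ++-cong (++-cong (++-concatMap A B xs) ≋-refl) ≋-refl ⟩
    (concatMap (λ x → A x ++ B x) xs ++ concatMap C xs) ++ concatMap D xs
      ≈⟨ ++-cong (++-concatMap (λ x → A x ++ B x) C xs) ≋-refl ⟩
    concatMap (λ x → (A x ++ B x) ++ C x) xs ++ concatMap D xs
      ≈⟨ ++-concatMap (λ x → (A x ++ B x) ++ C x) D xs ⟩
    concatMap (λ x → recurrenceRhs (T x) (T↑ x) (P x)) xs ∎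
    where
    open ≋-Reasoning
    A B C D : _ → Comb
    A x = combScale oneMinusT (combUp (T x))
    B x = combRight (T x)
    C x = combNeg (combScale oneMinusT (T↑ x))
    D x = combScale oneMinusT (P x)

  -- the terms of g_m(k ++ [c]) from the two splittings of k ++ [c] that restrict to the splitting C ++ [b] of k
  snocTerms : ℕ → Poly → Index → List Index → Index → ℕ → ℕ → Comb
  snocTerms φ Q π C b c m =
    blockTerms φ Q π (C ++ b ∷ [ c ] ∷ []) m ++ blockTerms φ (polyMul ρ Q) π (C ++ [ b ++ [ c ] ]) m

  predSnocTerms : ℕ → Poly → Index → List Index → Index → ℕ → ℕ → Comb
  predSnocTerms φ Q π C b c m =
    predBlockTerms φ Q π (C ++ b ∷ [ c ] ∷ []) m ++ predBlockTerms φ (polyMul ρ Q) π (C ++ [ b ++ [ c ] ]) m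

  module _ (φ : ℕ) (Q : Poly) (π : Index) (c : Index) where
    private
      Qₑ : ℕ → Poly
      Qₑ e = polyMul Q (blockFactor φ c e)
      πₑ : ℕ → Index
      πₑ e = π ++ [ sum c ℕ.+ e ]

    snocTerms-∷ : ∀ C b x m → snocTerms φ Q π (c ∷ C) b x m ≋ concatMap (λ e → snocTerms 0 (Qₑ e) (πₑ e) C b x (m ∸ e)) (upTo (suc m))
    snocTerms-∷ C b x m = ≋-trans
      (++-cong (Pointwise⇒≋ (blockTerms-∷ φ Q π c (C ++ b ∷ [ x ] ∷ []) m))
               (≋-trans (Pointwise⇒≋ (blockTerms-∷ φ (polyMul ρ Q) π c (C ++ [ b ++ [ x ] ]) m))
                        (concatMap-≋ (upTo (suc m)) λ e → Pointwise⇒≋ (blockTerms-cong 0 (πₑ e) (C ++ [ b ++ [ x ] ]) (m ∸ e) (polyMul-assoc ρ Q (blockFactor φ c e))))))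
      (++-concatMap (λ e → blockTerms 0 (Qₑ e) (πₑ e) (C ++ b ∷ [ x ] ∷ []) (m ∸ e))
                    (λ e → blockTerms 0 (polyMul ρ (Qₑ e)) (πₑ e) (C ++ [ b ++ [ x ] ]) (m ∸ e)) (upTo (suc m)))

    predSnocTerms-∷ : ∀ C b x m → predSnocTerms φ Q π (c ∷ C) b x m ≋ concatMap (λ e → predSnocTerms 0 (Qₑ e) (πₑ e) C b x (m ∸ e)) (upTo (suc m))
    predSnocTerms-∷ C b x m = ≋-trans
      (++-cong (predBlockTerms-∷ φ Q π c (C ++ b ∷ [ x ] ∷ []) m)
               (≋-trans (predBlockTerms-∷ φ (polyMul ρ Q) π c (C ++ [ b ++ [ x ] ]) m)
                        (concatMap-≋ (upTo (suc m)) λ e → predBlockTerms-cong 0 (πₑ e) (C ++ [ b ++ [ x ] ]) (m ∸ e) (polyMul-assoc ρ Q (blockFactor φ c e)))))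
      (++-concatMap (λ e → predBlockTerms 0 (Qₑ e) (πₑ e) (C ++ b ∷ [ x ] ∷ []) (m ∸ e))
                    (λ e → predBlockTerms 0 (polyMul ρ (Qₑ e)) (πₑ e) (C ++ [ b ++ [ x ] ]) (m ∸ e)) (upTo (suc m)))

  sum-snoc : ∀ b c → sum (b ++ [ c ]) ≡ c ℕ.+ sum b
  sum-snoc b c = trans (ListSum.sum-++ b [ c ]) (trans (ℕP.+-comm (sum b) (c ℕ.+ 0)) (cong (ℕ._+ sum b) (ℕP.+-identityʳ c)))

  sum-idxUp : ∀ b₀ bs → sum (idxUp (b₀ ∷ bs)) ≡ suc (sum (b₀ ∷ bs))
  sum-idxUp b₀ []        = refl
  sum-idxUp b₀ (b₁ ∷ bs) = trans (cong (b₀ ℕ.+_) (sum-idxUp b₁ bs)) (ℕP.+-suc b₀ (sum (b₁ ∷ bs)))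

  length-snoc : ∀ {A : Set} (xs : List A) x → length (xs ++ [ x ]) ≡ suc (length xs)
  length-snoc xs x = trans (List.length-++ xs) (ℕP.+-comm (length xs) 1)

  blockTerms-[_]′ : ∀ φ Q π d m {i k s} → length d ∸ 1 ≡ i → sum d ℕ.+ φ ≡ k → sum d ℕ.+ m ≡ s →
    blockTerms φ Q π [ d ] m ≡ [ (polyMul Q (polyMul (fPoly i (+ k) m) polyOne) , π ++ [ s ]) ]
  blockTerms-[_]′ φ Q π d m refl refl refl = blockTerms-[_] φ Q π d m

  ρ≈-t[1-t] : ρ ≈ₚ polyNeg (polyMul tPoly oneMinusT)
  ρ≈-t[1-t] = polyMul-neg-one (polyMul tPoly oneMinusT)

  -- fPoly-recurrence multiplied by −(1 − t)Q
  extendedBlock-coefficient : ∀ Q a A c d → polyAdd a (polyMul tPoly A) ≈ₚ polyAdd c (polyMul tPoly (polyMul oneMinusT d)) →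
    polyMul (polyMul ρ Q) (polyMul A polyOne)
      ≈ₚ polySum (polyMul oneMinusT (polyMul Q (polyMul a polyOne))
                ∷ polyMul (polyConst (ℚ.- 1ℚ)) (polyMul oneMinusT (polyMul Q (polyMul c polyOne)))
                ∷ polyMul oneMinusT (polyMul (polyMul ρ Q) (polyMul d polyOne)) ∷ [])
  extendedBlock-coefficient Q a A c d recurrence = begin
    polyMul (polyMul ρ Q) (polyMul A polyOne)
      ≈⟨ polyMul-congʳ (polyMul A polyOne) (polyMul-congʳ Q ρ≈-t[1-t]) ⟩
    polyMul (polyMul r Q) (polyMul A polyOne)
      ≈⟨ polyAdd-identityʳ L ⟨
    polyAdd (polyMul (polyMul r Q) (polyMul A polyOne)) []
      ≈⟨ polyAdd-congˡ L (≈ₚ-trans (polyMul-congˡ (polyMul oneMinusT Q) difference≈0) (polyMul-zeroʳ (polyMul oneMinusT Q))) ⟨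
    polyAdd (polyMul (polyMul r Q) (polyMul A polyOne)) (polyMul (polyMul oneMinusT Q) difference)
      ≈⟨ ring tPoly oneMinusT Q a A c d ⟨
    polySum (polyMul oneMinusT (polyMul Q (polyMul a polyOne)) ∷ polyNeg (polyMul oneMinusT (polyMul Q (polyMul c polyOne)))
            ∷ polyMul oneMinusT (polyMul (polyMul r Q) (polyMul d polyOne)) ∷ [])
      ≈⟨ polyAdd-congˡ x (polyAdd-cong (≈ₚ-sym (polyMul-neg-one y))
           (polyAdd-congʳ [] (polyMul-congˡ oneMinusT (polyMul-congʳ (polyMul d polyOne) (polyMul-congʳ Q (≈ₚ-sym ρ≈-t[1-t])))))) ⟩
    polySum (polyMul oneMinusT (polyMul Q (polyMul a polyOne)) ∷ polyMul (polyConst (ℚ.- 1ℚ)) (polyMul oneMinusT (polyMul Q (polyMul c polyOne)))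
            ∷ polyMul oneMinusT (polyMul (polyMul ρ Q) (polyMul d polyOne)) ∷ []) ∎
    where
    open ≈ₚ-Reasoning
    r = polyNeg (polyMul tPoly oneMinusT)
    L = polyMul (polyMul r Q) (polyMul A polyOne)
    x = polyMul oneMinusT (polyMul Q (polyMul a polyOne))
    y = polyMul oneMinusT (polyMul Q (polyMul c polyOne))
    difference = polyAdd (polyAdd a (polyMul tPoly A)) (polyNeg (polyAdd c (polyMul tPoly (polyMul oneMinusT d))))
    difference≈0 : difference ≈ₚ []
    difference≈0 = ≈ₚ-trans (polyAdd-congʳ (polyNeg (polyAdd c (polyMul tPoly (polyMul oneMinusT d)))) recurrence)
                            (polyNeg-inverseʳ (polyAdd c (polyMul tPoly (polyMul oneMinusT d))))
    ring : ∀ t u Q a A c d →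
      polyAdd (polyMul u (polyMul Q (polyMul a polyOne))) (polyAdd (polyNeg (polyMul u (polyMul Q (polyMul c polyOne))))
        (polyAdd (polyMul u (polyMul (polyMul (polyNeg (polyMul t u)) Q) (polyMul d polyOne))) []))
      ≈ₚ polyAdd (polyMul (polyMul (polyNeg (polyMul t u)) Q) (polyMul A polyOne))
                 (polyMul (polyMul u Q) (polyAdd (polyAdd a (polyMul t A)) (polyNeg (polyAdd c (polyMul t (polyMul u d))))))
    ring = solve-∀ polyAlmostCommutativeRing

  extendedBlock-coefficient-zero : ∀ Q a A → A ≈ₚ [] →
    polyMul (polyMul ρ Q) (polyMul A polyOne)
      ≈ₚ polySum (polyMul oneMinusT (polyMul Q (polyMul a polyOne))
                ∷ polyMul (polyConst (ℚ.- 1ℚ)) (polyMul oneMinusT (polyMul Q (polyMul a polyOne))) ∷ [])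
  extendedBlock-coefficient-zero Q a A A≈0 = begin
    polyMul (polyMul ρ Q) (polyMul A polyOne)    ≈⟨ polyMul-congˡ (polyMul ρ Q) (polyMul-congʳ polyOne A≈0) ⟩
    polyMul (polyMul ρ Q) []                     ≈⟨ polyMul-zeroʳ (polyMul ρ Q) ⟩
    []                                           ≈⟨ polyNeg-inverseʳ x ⟨
    polyAdd x (polyNeg x)                        ≈⟨ polyAdd-congˡ x (≈ₚ-trans (polyAdd-identityʳ (polyMul (polyConst (ℚ.- 1ℚ)) x)) (polyMul-neg-one x)) ⟨
    polyAdd x (polyAdd (polyMul (polyConst (ℚ.- 1ℚ)) x) []) ∎
    where
    open ≈ₚ-Reasoning
    x = polyMul oneMinusT (polyMul Q (polyMul a polyOne))

  module _ (φ : ℕ) (Q : Poly) (π : Index) (b₀ : ℕ) (bs : Index) where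
    private
      b = b₀ ∷ bs
      S = sum b
      K = S ℕ.+ φ
      i = length bs

    extendedBlock-terms : ∀ m → blockTerms φ (polyMul ρ Q) π [ b ++ [ 1 ] ] m
      ≋ (combScale oneMinusT (combUp (blockTerms φ Q π [ b ] m)) ++ combNeg (combScale oneMinusT (blockTerms φ Q π [ idxUp b ] m)))
        ++ combScale oneMinusT (predBlockTerms φ (polyMul ρ Q) π [ b ++ [ 2 ] ] m)
    extendedBlock-terms m = begin
      blockTerms φ (polyMul ρ Q) π [ b ++ [ 1 ] ] m
        ≡⟨ blockTerms-[_]′ φ (polyMul ρ Q) π (b ++ [ 1 ]) m (length-snoc bs 1) (cong (ℕ._+ φ) (sum-snoc b 1)) (cong (ℕ._+ m) (sum-snoc b 1)) ⟩
      [ (polyMul (polyMul ρ Q) (polyMul (fPoly (suc i) (+ suc K) m) polyOne) , κ) ]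
        ≈⟨ coefficients m ⟩
      map (_, κ) (polyMul oneMinusT (polyMul Q (polyMul (fPoly i (+ K) m) polyOne))
                ∷ polyMul (polyConst (ℚ.- 1ℚ)) (polyMul oneMinusT (polyMul Q (polyMul (fPoly i (+ suc K) m) polyOne)))
                ∷ pred m)
        ≡⟨ cong₂ _++_ (cong₂ _++_ up-≡ neg-≡) (pred-≡ m) ⟨
      (combScale oneMinusT (combUp (blockTerms φ Q π [ b ] m)) ++ combNeg (combScale oneMinusT (blockTerms φ Q π [ idxUp b ] m)))
        ++ combScale oneMinusT (predBlockTerms φ (polyMul ρ Q) π [ b ++ [ 2 ] ] m) ∎
      where
      open ≋-Reasoning
      κ = π ++ [ suc (S ℕ.+ m) ]
      pred : ℕ → List Poly
      pred zero     = []
      pred (suc m′) = polyMul oneMinusT (polyMul (polyMul ρ Q) (polyMul (fPoly (suc i) (+ suc (suc K)) m′) polyOne)) ∷ []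
      up-≡ : combScale oneMinusT (combUp (blockTerms φ Q π [ b ] m)) ≡ [ (polyMul oneMinusT (polyMul Q (polyMul (fPoly i (+ K) m) polyOne)) , κ) ]
      up-≡ = trans (cong (combScale oneMinusT ∘ combUp) (blockTerms-[_] φ Q π b m))
                   (cong (λ κ′ → [ (polyMul oneMinusT (polyMul Q (polyMul (fPoly i (+ K) m) polyOne)) , κ′) ]) (idxUp-snoc π (S ℕ.+ m)))
      neg-≡ : combNeg (combScale oneMinusT (blockTerms φ Q π [ idxUp b ] m))
            ≡ [ (polyMul (polyConst (ℚ.- 1ℚ)) (polyMul oneMinusT (polyMul Q (polyMul (fPoly i (+ suc K) m) polyOne))) , κ) ]
      neg-≡ = cong (combNeg ∘ combScale oneMinusT)
        (blockTerms-[_]′ φ Q π (idxUp b) m (cong (_∸ 1) (length-idxUp b)) (cong (ℕ._+ φ) (sum-idxUp b₀ bs)) (cong (ℕ._+ m) (sum-idxUp b₀ bs)))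
      pred-≡ : ∀ m → combScale oneMinusT (predBlockTerms φ (polyMul ρ Q) π [ b ++ [ 2 ] ] m) ≡ map (_, π ++ [ suc (S ℕ.+ m) ]) (pred m)
      pred-≡ zero     = refl
      pred-≡ (suc m′) = cong (combScale oneMinusT)
        (blockTerms-[_]′ φ (polyMul ρ Q) π (b ++ [ 2 ]) m′ (length-snoc bs 2) (cong (ℕ._+ φ) (sum-snoc b 2))
          (trans (cong (ℕ._+ m′) (sum-snoc b 2)) (cong suc (sym (ℕP.+-suc S m′)))))
      coefficients : ∀ m → [ (polyMul (polyMul ρ Q) (polyMul (fPoly (suc i) (+ suc K) m) polyOne) , π ++ [ suc (S ℕ.+ m) ]) ]
        ≋ map (_, π ++ [ suc (S ℕ.+ m) ]) (polyMul oneMinusT (polyMul Q (polyMul (fPoly i (+ K) m) polyOne))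
                ∷ polyMul (polyConst (ℚ.- 1ℚ)) (polyMul oneMinusT (polyMul Q (polyMul (fPoly i (+ suc K) m) polyOne)))
                ∷ pred m)
      coefficients zero     = singleton-≋ _ _ _ (extendedBlock-coefficient-zero Q (fPoly i (+ K) 0) (fPoly (suc i) (+ suc K) 0) (fPoly-suc-zero i (+ suc K)))
      coefficients (suc m′) = singleton-≋ _ _ _ (extendedBlock-coefficient Q (fPoly i (+ K) (suc m′)) (fPoly (suc i) (+ suc K) (suc m′))
                                                  (fPoly i (+ suc K) (suc m′)) (fPoly (suc i) (+ suc (suc K)) m′) (fPoly-recurrence i (+ K) m′))

    private
      pairTerms : Poly → Index → ℕ → ℕ → Poly × Index
      pairTerms Q′ d n e = (polyMul Q′ (fProd φ (b ∷ d ∷ []) (e ∷ (n ∸ e) ∷ [])) , π ++ blockIndex (b ∷ d ∷ []) (e ∷ (n ∸ e) ∷ []))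

      blockTerms-pair : ∀ Q′ d n → blockTerms φ Q′ π (b ∷ d ∷ []) n ≡ map (pairTerms Q′ d n) (upTo (suc n))
      blockTerms-pair Q′ d n = trans (cong (map _) (weakComps-2 n)) (sym (List.map-∘ (upTo (suc n))))

    newBlock-terms : ∀ m → blockTerms φ Q π (b ∷ [ 1 ] ∷ []) m
      ≋ combRight (blockTerms φ Q π [ b ] m) ++ combScale oneMinusT (predBlockTerms φ Q π (b ∷ [ 2 ] ∷ []) m)
    newBlock-terms m = begin
      blockTerms φ Q π (b ∷ [ 1 ] ∷ []) m          ≡⟨ blockTerms-pair Q [ 1 ] m ⟩
      map H (upTo (suc m))                          ≡⟨ cong (map H) (List.upTo-∷ʳ m) ⟨
      map H (upTo m ++ [ m ])                       ≡⟨ List.map-++ H (upTo m) [ m ] ⟩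
      map H (upTo m) ++ [ H m ]                     ≈⟨ ++-comm (map H (upTo m)) [ H m ] ⟩
      [ H m ] ++ map H (upTo m)                     ≈⟨ ++-cong (Pointwise⇒≋ (last ∷ [])) (earlier m) ⟩
      [ (polyMul Q (polyMul (f m) polyOne) , (π ++ [ S ℕ.+ m ]) ++ [ 1 ]) ] ++ combScale oneMinusT (predBlockTerms φ Q π (b ∷ [ 2 ] ∷ []) m)
        ≡⟨ cong (λ T → combRight T ++ combScale oneMinusT (predBlockTerms φ Q π (b ∷ [ 2 ] ∷ []) m)) (blockTerms-[_] φ Q π b m) ⟨
      combRight (blockTerms φ Q π [ b ] m) ++ combScale oneMinusT (predBlockTerms φ Q π (b ∷ [ 2 ] ∷ []) m) ∎
      where
      open ≋-Reasoning
      H = pairTerms Q [ 1 ] m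
      f = blockFactor φ b
      last : H m ≈ₜ (polyMul Q (polyMul (f m) polyOne) , (π ++ [ S ℕ.+ m ]) ++ [ 1 ])
      last = polyMul-congˡ Q (polyMul-congˡ (f m) (≈ₚ-trans (polyMul-identityʳ _) (≈ₚ-trans (≡⇒≈ₚ (cong (fPoly 0 (+ 1)) (ℕP.n∸n≡0 m))) (fPoly-0-zero (+ 1)))))
           , trans (cong (λ n → π ++ (S ℕ.+ m) ∷ suc n ∷ []) (ℕP.n∸n≡0 m)) (sym (List.++-assoc π [ S ℕ.+ m ] [ 1 ]))
      earlier : ∀ m → map (pairTerms Q [ 1 ] m) (upTo m) ≋ combScale oneMinusT (predBlockTerms φ Q π (b ∷ [ 2 ] ∷ []) m)
      earlier zero     = ≋-refl
      earlier (suc m′) = begin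
        map (pairTerms Q [ 1 ] (suc m′)) (upTo (suc m′))
          ≈⟨ Pointwise⇒≋ (map-≈ₜ-All (All.map shifted (all-upTo (suc m′)))) ⟩
        map (λ e → (polyMul oneMinusT (proj₁ (pairTerms Q [ 2 ] m′ e)) , proj₂ (pairTerms Q [ 2 ] m′ e))) (upTo (suc m′))
          ≡⟨ trans (List.map-∘ (upTo (suc m′))) (cong (combScale oneMinusT) (sym (blockTerms-pair Q [ 2 ] m′))) ⟩
        combScale oneMinusT (blockTerms φ Q π (b ∷ [ 2 ] ∷ []) m′) ∎
        where
        shifted : ∀ {e} → e < suc m′ → pairTerms Q [ 1 ] (suc m′) e ≈ₜ (polyMul oneMinusT (proj₁ (pairTerms Q [ 2 ] m′ e)) , proj₂ (pairTerms Q [ 2 ] m′ e))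
        shifted {e} e<1+m′ =
            ≈ₚ-trans (polyMul-congˡ Q (polyMul-congˡ (f e) (polyMul-congʳ polyOne
              (≈ₚ-trans (≡⇒≈ₚ (cong (fPoly 0 (+ 1)) (m∸n≡1+m∸[1+n] e<1+m′))) (fPoly-0-1-suc (m′ ∸ e))))))
            (≈ₚ-trans (swap Q (f e) oneMinusT)
              (polyMul-congˡ oneMinusT (polyMul-congˡ Q (polyMul-congˡ (f e) (polyMul-congʳ polyOne (≈ₚ-sym (fPoly-0-2 (m′ ∸ e))))))))
          , cong (λ n → π ++ (S ℕ.+ e) ∷ suc n ∷ []) (m∸n≡1+m∸[1+n] e<1+m′)
          where
          swap : ∀ Q f u → polyMul Q (polyMul f (polyMul u polyOne)) ≈ₚ polyMul u (polyMul Q (polyMul f (polyMul polyOne polyOne)))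
          swap = solve-∀ polyAlmostCommutativeRing

  lastBlockIdentity : ∀ C φ Q π b₀ bs m → let b = b₀ ∷ bs in
    snocTerms φ Q π C b 1 m ≋ recurrenceRhs (blockTerms φ Q π (C ++ [ b ]) m) (blockTerms φ Q π (C ++ [ idxUp b ]) m) (predSnocTerms φ Q π C b 2 m)
  lastBlockIdentity [] φ Q π b₀ bs m = begin
    blockTerms φ Q π (b ∷ [ 1 ] ∷ []) m ++ blockTerms φ (polyMul ρ Q) π [ b ++ [ 1 ] ] m
      ≈⟨ ++-cong (newBlock-terms φ Q π b₀ bs m) (extendedBlock-terms φ Q π b₀ bs m) ⟩
    (R ++ U₁) ++ ((Up ++ N) ++ U₂)
      ≈⟨ rearrange R U₁ Up N U₂ ⟩
    ((Up ++ R) ++ N) ++ (U₁ ++ U₂)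
      ≡⟨ cong (((Up ++ R) ++ N) ++_) (List.map-++ _ (predBlockTerms φ Q π (b ∷ [ 2 ] ∷ []) m) (predBlockTerms φ (polyMul ρ Q) π [ b ++ [ 2 ] ] m)) ⟨
    recurrenceRhs (blockTerms φ Q π [ b ] m) (blockTerms φ Q π [ idxUp b ] m) (predSnocTerms φ Q π [] b 2 m) ∎
    where
    open ≋-Reasoning
    open import Algebra.Solver.CommutativeMonoid combCommutativeMonoid using (solve; _⊕_; _⊜_)
    b = b₀ ∷ bs
    R  = combRight (blockTerms φ Q π [ b ] m)
    Up = combScale oneMinusT (combUp (blockTerms φ Q π [ b ] m))
    N  = combNeg (combScale oneMinusT (blockTerms φ Q π [ idxUp b ] m))
    U₁ = combScale oneMinusT (predBlockTerms φ Q π (b ∷ [ 2 ] ∷ []) m)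
    U₂ = combScale oneMinusT (predBlockTerms φ (polyMul ρ Q) π [ b ++ [ 2 ] ] m)
    rearrange : ∀ r u₁ up n u₂ → ((r ++ u₁) ++ ((up ++ n) ++ u₂)) ≋ (((up ++ r) ++ n) ++ (u₁ ++ u₂))
    rearrange = solve 5 (λ r u₁ up n u₂ → (r ⊕ u₁) ⊕ ((up ⊕ n) ⊕ u₂) ⊜ ((up ⊕ r) ⊕ n) ⊕ (u₁ ⊕ u₂)) ≋-refl
  lastBlockIdentity (c ∷ C) φ Q π b₀ bs m = begin
    snocTerms φ Q π (c ∷ C) b 1 m
      ≈⟨ snocTerms-∷ φ Q π c C b 1 m ⟩
    concatMap (λ e → snocTerms 0 (Qₑ e) (πₑ e) C b 1 (m ∸ e)) (upTo (suc m))
      ≈⟨ concatMap-≋ (upTo (suc m)) (λ e → lastBlockIdentity C 0 (Qₑ e) (πₑ e) b₀ bs (m ∸ e)) ⟩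
    concatMap (λ e → recurrenceRhs (T e) (T↑ e) (P e)) (upTo (suc m))
      ≈⟨ recurrenceRhs-concatMap T T↑ P (upTo (suc m)) ⟨
    recurrenceRhs (concatMap T (upTo (suc m))) (concatMap T↑ (upTo (suc m))) (concatMap P (upTo (suc m)))
      ≈⟨ recurrenceRhs-cong (Pointwise.symmetric ≈ₜ-sym (blockTerms-∷ φ Q π c (C ++ [ b ]) m))
                            (≋-sym (Pointwise⇒≋ (blockTerms-∷ φ Q π c (C ++ [ idxUp b ]) m)))
                            (≋-sym (predSnocTerms-∷ φ Q π c C b 2 m)) ⟩
    recurrenceRhs (blockTerms φ Q π (c ∷ C ++ [ b ]) m) (blockTerms φ Q π (c ∷ C ++ [ idxUp b ]) m) (predSnocTerms φ Q π (c ∷ C) b 2 m) ∎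
    where
    open ≋-Reasoning
    b = b₀ ∷ bs
    Qₑ : ℕ → Poly
    Qₑ e = polyMul Q (blockFactor φ c e)
    πₑ : ℕ → Index
    πₑ e = π ++ [ sum c ℕ.+ e ]
    T T↑ P : ℕ → Comb
    T  e = blockTerms 0 (Qₑ e) (πₑ e) (C ++ [ b ]) (m ∸ e)
    T↑ e = blockTerms 0 (Qₑ e) (πₑ e) (C ++ [ idxUp b ]) (m ∸ e)
    P  e = predSnocTerms 0 (Qₑ e) (πₑ e) C b 2 (m ∸ e)

open Combinations
open Splittings
open Expansion
open import Data.Nat using (zero; suc; _∸_)
import Data.Nat.Properties as ℕP
open import Data.List using ([]; concatMap; _++_; [_]; length; initLast; _∷ʳ′_)
import Data.List.Properties as List
open import Data.List.Relation.Unary.All using ([]; _∷_)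
open import Data.List.Relation.Unary.All.Properties using (++⁻ʳ)
open import Data.Product using (_,_)
open import Function using (_∘′_)
open import Relation.Binary.PropositionalEquality hiding ([_])

gPart : ℕ → Index → List Index → Comb
gPart m k B = blockTerms 1 (polyPow ρ (length k ∸ length B)) [] B m

snocParts : ℕ → Index → ℕ → List Index → Comb
snocParts m k c B = gPart m (k ++ [ c ]) (B ++ [ [ c ] ]) ++ gPart m (k ++ [ c ]) (mapLast (_++ [ c ]) B)

predSnocParts : ℕ → Index → ℕ → List Index → Comb
predSnocParts zero    k c B = []
predSnocParts (suc m) k c B = snocParts m k c B

g-snoc : ∀ m c k₁ ks → g m ((k₁ ∷ ks) ++ [ c ]) ≋ concatMap (snocParts m (k₁ ∷ ks) c) (splits (k₁ ∷ ks))
g-snoc m c k₁ ks = splits-snoc c k₁ ks (gPart m ((k₁ ∷ ks) ++ [ c ]))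

g-idxUp : ∀ m k₁ ks → g m (idxUp (k₁ ∷ ks)) ≡ concatMap (gPart m (idxUp (k₁ ∷ ks)) ∘′ mapLast idxUp) (splits (k₁ ∷ ks))
g-idxUp m k₁ ks = trans (cong (concatMap (gPart m (idxUp (k₁ ∷ ks)))) (splits-idxUp k₁ ks))
                        (List.concatMap-map (gPart m (idxUp (k₁ ∷ ks))) (mapLast idxUp) (splits (k₁ ∷ ks)))

gPred-idxRightUp : ∀ m k₁ ks → gPred m (idxRightUp (k₁ ∷ ks)) ≋ concatMap (predSnocParts m (k₁ ∷ ks) 2) (splits (k₁ ∷ ks))
gPred-idxRightUp zero    k₁ ks = ≡⇒≋ (sym (concatMap-[] (splits (k₁ ∷ ks))))
gPred-idxRightUp (suc m) k₁ ks = ≋-trans (≡⇒≋ (cong (g m) (idxUp-snoc (k₁ ∷ ks) 1))) (g-snoc m 2 k₁ ks)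

gPart-≡ : ∀ m k B {n} → length k ∸ length B ≡ n → gPart m k B ≡ blockTerms 1 (polyPow ρ n) [] B m
gPart-≡ m k B refl = refl

snocParts-identity : ∀ k m {B} → SplittingShape k B →
  snocParts m k 1 B ≋ recurrenceRhs (gPart m k B) (gPart m (idxUp k) (mapLast idxUp B)) (predSnocParts m k 2 B)
snocParts-identity k m {B} (B≢[] , blocks≢[] , B≤k) with initLast B
... | C ∷ʳ′ b with ++⁻ʳ C blocks≢[]
... | nonEmpty {b₀} {bs} ∷ [] = begin
  snocParts m k 1 (C ++ [ b ])
    ≡⟨ snocTerms-≡ 1 m ⟩
  snocTerms 1 (polyPow ρ n) [] C b 1 m
    ≈⟨ lastBlockIdentity C 1 (polyPow ρ n) [] b₀ bs m ⟩
  recurrenceRhs (blockTerms 1 (polyPow ρ n) [] (C ++ [ b ]) m) (blockTerms 1 (polyPow ρ n) [] (C ++ [ idxUp b ]) m) (predSnocTerms 1 (polyPow ρ n) [] C b 2 m)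
    ≡⟨ cong₂ (recurrenceRhs (gPart m k (C ++ [ b ]))) up-≡ (pred-≡ m) ⟨
  recurrenceRhs (gPart m k (C ++ [ b ])) (gPart m (idxUp k) (mapLast idxUp (C ++ [ b ]))) (predSnocParts m k 2 (C ++ [ b ])) ∎
  where
  open ≋-Reasoning
  n = length k ∸ length (C ++ [ b ])
  |C|<|k| : suc (length C) ≤ length k
  |C|<|k| = subst (_≤ length k) (length-snoc C b) B≤k
  snocTerms-≡ : ∀ c m → snocParts m k c (C ++ [ b ]) ≡ snocTerms 1 (polyPow ρ n) [] C b c m
  snocTerms-≡ c m = cong₂ _++_
    (trans (cong (gPart m (k ++ [ c ])) (List.++-assoc C [ b ] [ [ c ] ]))
           (gPart-≡ m (k ++ [ c ]) (C ++ b ∷ [ c ] ∷ [])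
             (trans (cong₂ _∸_ (length-snoc k c) (trans (List.length-++ C) (ℕP.+-comm (length C) 2))) (cong (length k ∸_) (sym (length-snoc C b))))))
    (trans (cong (gPart m (k ++ [ c ])) (mapLast-snoc (_++ [ c ]) C b))
           (gPart-≡ m (k ++ [ c ]) (C ++ [ b ++ [ c ] ]) (trans (cong₂ _∸_ (length-snoc k c) (length-snoc C (b ++ [ c ])))
             (trans (ℕP.+-∸-assoc 1 |C|<|k|) (cong suc (cong (length k ∸_) (sym (length-snoc C b))))))))
  up-≡ : gPart m (idxUp k) (mapLast idxUp (C ++ [ b ])) ≡ blockTerms 1 (polyPow ρ n) [] (C ++ [ idxUp b ]) m
  up-≡ = trans (cong (gPart m (idxUp k)) (mapLast-snoc idxUp C b))
               (gPart-≡ m (idxUp k) (C ++ [ idxUp b ]) (cong₂ _∸_ (length-idxUp k) (trans (length-snoc C (idxUp b)) (sym (length-snoc C b)))))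
  pred-≡ : ∀ m → predSnocParts m k 2 (C ++ [ b ]) ≡ predSnocTerms 1 (polyPow ρ n) [] C b 2 m
  pred-≡ zero    = refl
  pred-≡ (suc m) = snocTerms-≡ 2 m

-- The identity holds for every non-empty index; positivity of its entries is not needed.
proposition2p4 : (k₁ : ℕ) (ks : List ℕ) → All (1 ≤_) (k₁ ∷ ks) → (m : ℕ) →
    g m (idxRight (k₁ ∷ ks))
      ≈ᶜ combAdd (combAdd (combAdd (combScale oneMinusT (combUp (g m (k₁ ∷ ks))))
                                   (combRight (g m (k₁ ∷ ks))))
                          (combNeg (combScale oneMinusT (g m (idxUp (k₁ ∷ ks))))))
                 (combScale oneMinusT (gPred m (idxRightUp (k₁ ∷ ks))))
proposition2p4 k₁ ks _ m = ≋⇒≈ᶜ (begin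
  g m (k ++ [ 1 ])
    ≈⟨ g-snoc m 1 k₁ ks ⟩
  concatMap (snocParts m k 1) (splits k)
    ≈⟨ concatMap-≋-All (snocParts-identity k m) (splits-shape k₁ ks) ⟩
  concatMap (λ B → recurrenceRhs (gPart m k B) (gPart m (idxUp k) (mapLast idxUp B)) (predSnocParts m k 2 B)) (splits k)
    ≈⟨ recurrenceRhs-concatMap (gPart m k) (gPart m (idxUp k) ∘′ mapLast idxUp) (predSnocParts m k 2) (splits k) ⟨
  recurrenceRhs (g m k) (concatMap (gPart m (idxUp k) ∘′ mapLast idxUp) (splits k)) (concatMap (predSnocParts m k 2) (splits k))
    ≈⟨ recurrenceRhs-congʳ (g m k) _ (≋-sym (gPred-idxRightUp m k₁ ks)) ⟩
  recurrenceRhs (g m k) (concatMap (gPart m (idxUp k) ∘′ mapLast idxUp) (splits k)) (gPred m (idxRightUp k))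
    ≡⟨ cong (λ T↑ → recurrenceRhs (g m k) T↑ (gPred m (idxRightUp k))) (g-idxUp m k₁ ks) ⟨
  recurrenceRhs (g m k) (g m (idxUp k)) (gPred m (idxRightUp k)) ∎)
  where
  open ≋-Reasoning
  k = k₁ ∷ ks
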